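{- Let $T$ be a tree and let $P$ be a diametrical path of $T$. If $\operatorname{mr}^-(T)=\operatorname{mr}^-(P)$, then $T$ is a centipede. Moreover, if in addition $|P|$ (the number of vertices of $P$) is odd, then $T$ is a regular centipede.
   Context: All graphs are finite, simple and undirected. For a graph $G$ with vertices $v_1,\dots,v_m$, let $\mathcal{S}^-(G)$ be the set of real skew-symmetric $m\times m$ matrices $A$ such that for $i\neq j$, $a_{ij}\neq 0$ if and only if $\{v_i,v_j\}$ is an edge of $G$. The minimum skew rank is $\operatorname{mr}^-(G)=\min\{\operatorname{rank}A : A\in\mathcal{S}^-(G)\}$. The distance between two vertices of a connected graph is the number of edges of a shortest path joining them, $\operatorname{diam}(G)$ is the maximum distance, and a diametrical path of a connected graph $G$ is an induced path in $G$ of length (number of edges) $\operatorname{diam}(G)$. A centipede is a tree consisting of a path $P$ together with additional edges (legs) each joining a nonpendant vertex of $P$ to a new pendant vertex; the vertices of $P$ that have legs are called joints. A centipede is regular if no two consecutive vertices of $P$ are joints, and irregular otherwise. -}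

module Defs where

open import Level using (0ℓ)
open import Data.Nat using (ℕ; zero; suc; _≤_; _<_)
open import Data.Fin using (Fin; zero; suc; toℕ; inject₁; fromℕ)
open import Data.Bool using (Bool; true; false)
open import Data.Product using (Σ; ∃; ∃-syntax; _×_; _,_)
open import Data.Sum using (_⊎_)
open import Relation.Nullary using (¬_)
open import Relation.Binary.PropositionalEquality using (_≡_; _≢_)
open import Relation.Binary.Structures using (IsStrictTotalOrder)
open import Algebra.Structures using (IsCommutativeRing)
open import Function.Definitions using (Injective)

-- The real numbers, axiomatised as a (Dedekind-)complete ordered field.
-- The statement quantifies over every such model (all are isomorphic).

record RealNumbers : Set₁ where
  infixl 6 _+_
  infixl 7 _*_
  infix 4 _<ℝ_ _≤ℝ_
  field
    ℝ   : Set
    _+_ : ℝ → ℝ → ℝ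
    _*_ : ℝ → ℝ → ℝ
    -_  : ℝ → ℝ
    0ℝ  : ℝ
    1ℝ  : ℝ
    _<ℝ_ : ℝ → ℝ → Set
    isCommutativeRing : IsCommutativeRing _≡_ _+_ _*_ -_ 0ℝ 1ℝ
    nontrivial : 0ℝ ≢ 1ℝ
    inverse : ∀ x → x ≢ 0ℝ → ∃[ y ] (x * y ≡ 1ℝ)
    isStrictTotalOrder : IsStrictTotalOrder _≡_ _<ℝ_
    +-mono-< : ∀ x y z → x <ℝ y → x + z <ℝ y + z
    *-pos : ∀ x y → 0ℝ <ℝ x → 0ℝ <ℝ y → 0ℝ <ℝ x * y

  _≤ℝ_ : ℝ → ℝ → Set
  x ≤ℝ y = x <ℝ y ⊎ x ≡ y

  field
    complete : (S : ℝ → Set) → ∃[ x ] S x → ∃[ b ] (∀ x → S x → x ≤ℝ b) →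
               ∃[ s ] ((∀ x → S x → x ≤ℝ s) ×
                       (∀ b → (∀ x → S x → x ≤ℝ b) → s ≤ℝ b))

record Graph (n : ℕ) : Set where
  field
    adj   : Fin n → Fin n → Bool
    sym   : ∀ u v → adj u v ≡ adj v u
    irrefl : ∀ v → adj v v ≡ false

open Graph public

Edge : ∀ {n} → Graph n → Fin n → Fin n → Set
Edge G u v = adj G u v ≡ true

IsPath : ∀ {n} (G : Graph n) (k : ℕ) → (Fin (suc k) → Fin n) → Set
IsPath G k p = Injective _≡_ _≡_ p × (∀ (i : Fin k) → Edge G (p (inject₁ i)) (p (suc i)))

IsInduced : ∀ {n} (G : Graph n) (k : ℕ) → (Fin (suc k) → Fin n) → Set
IsInduced G k p = ∀ (i j : Fin (suc k)) → Edge G (p i) (p j) →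
                  toℕ i ≡ suc (toℕ j) ⊎ toℕ j ≡ suc (toℕ i)

PathFromTo : ∀ {n} (G : Graph n) (k : ℕ) → Fin n → Fin n → (Fin (suc k) → Fin n) → Set
PathFromTo G k u v p = IsPath G k p × p zero ≡ u × p (fromℕ k) ≡ v

Connected : ∀ {n} → Graph n → Set
Connected G = ∀ u v → ∃[ k ] ∃[ p ] PathFromTo G k u v p

Acyclic : ∀ {n} → Graph n → Set
Acyclic G = ¬ (∃[ k ] ∃[ p ] (2 ≤ k × IsPath G k p × Edge G (p (fromℕ k)) (p zero)))

IsTree : ∀ {n} → Graph n → Set
IsTree {n} G = 1 ≤ n × Connected G × Acyclic G

Dist : ∀ {n} → Graph n → Fin n → Fin n → ℕ → Set
Dist G u v d = (∃[ p ] PathFromTo G d u v p) ×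
               (∀ k p → PathFromTo G k u v p → d ≤ k)

IsDiameter : ∀ {n} → Graph n → ℕ → Set
IsDiameter G d = (∃[ u ] ∃[ v ] Dist G u v d) × (∀ u v e → Dist G u v e → e ≤ d)

IsDiametricalPath : ∀ {n} (G : Graph n) (k : ℕ) → (Fin (suc k) → Fin n) → Set
IsDiametricalPath G k p = IsPath G k p × IsInduced G k p × IsDiameter G k

inducedOn : ∀ {n m} → Graph n → (Fin m → Fin n) → Graph m
inducedOn G p = record
  { adj = λ i j → adj G (p i) (p j)
  ; sym = λ i j → sym G (p i) (p j)
  ; irrefl = λ i → irrefl G (p i) }

module SkewRank (R : RealNumbers) where
  open RealNumbers R

  sumFin : ∀ {r} → (Fin r → ℝ) → ℝ
  sumFin {zero} f = 0ℝ
  sumFin {suc r} f = f zero + sumFin (λ i → f (suc i))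

  Matrix : ℕ → ℕ → Set
  Matrix m k = Fin m → Fin k → ℝ

  InSkew : ∀ {m} → Graph m → Matrix m m → Set
  InSkew G A = (∀ i j → A i j ≡ - A j i) ×
               (∀ i j → i ≢ j → (A i j ≢ 0ℝ → Edge G i j) × (Edge G i j → A i j ≢ 0ℝ))

  RankAtMost : ∀ {m} → Matrix m m → ℕ → Set
  RankAtMost {m} A r = Σ (Matrix m r) λ B → Σ (Matrix r m) λ C → (∀ i j → A i j ≡ sumFin {r} (λ l → B i l * C l j))

  Rank : ∀ {m} → Matrix m m → ℕ → Set
  Rank A r = RankAtMost A r × (∀ s → RankAtMost A s → r ≤ s)

  MinSkewRank : ∀ {m} → Graph m → ℕ → Set
  MinSkewRank G k = (∃[ A ] (InSkew G A × Rank A k)) ×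
                    (∀ A r → InSkew G A → Rank A r → k ≤ r)

OnSpine : ∀ {n k} → (Fin (suc k) → Fin n) → Fin n → Set
OnSpine q v = ∃[ i ] q i ≡ v

IsCentipedeSpine : ∀ {n} (G : Graph n) (k : ℕ) → (Fin (suc k) → Fin n) → Set
IsCentipedeSpine G k q =
  IsPath G k q × IsInduced G k q ×
  -- every vertex off the spine is a pendant vertex (leg) attached to a
  -- nonpendant (interior) vertex of the spine
  (∀ v → ¬ OnSpine q v →
     ∃[ i ] ((0 < toℕ i × toℕ i < k) × Edge G (q i) v × (∀ w → Edge G v w → w ≡ q i)))

IsJoint : ∀ {n} (G : Graph n) (k : ℕ) → (Fin (suc k) → Fin n) → Fin (suc k) → Set
IsJoint G k q i = ∃[ v ] (¬ OnSpine q v × Edge G (q i) v)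

IsCentipede : ∀ {n} → Graph n → Set
IsCentipede G = ∃[ k ] ∃[ q ] IsCentipedeSpine G k q

IsRegularCentipede : ∀ {n} → Graph n → Set
IsRegularCentipede G = ∃[ k ] ∃[ q ] (IsCentipedeSpine G k q ×
  (∀ (i : Fin k) → ¬ (IsJoint G k q (inject₁ i) × IsJoint G k q (suc i))))

-- If x₁y₁, …, x_c y_c are edges of G such that each xᵢ is adjacent to no later endpoint, then every
-- A ∈ S⁻(G) has a nonsingular 2c × 2c minor on these vertices (it is block triangular with invertible
-- skew 2 × 2 diagonal blocks), so mr⁻(G) ≥ 2c. The signed adjacency matrix of a path on m vertices
-- has rank 2⌊m/2⌋, so mr⁻(P) ≤ 2⌊|P|/2⌋. An edge xy of T with x not adjacent to P, followed by a
-- maximum matching of P, would give mr⁻(T) > mr⁻(P); hence every vertex off P is adjacent to P,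
-- and since T is acyclic and P is diametrical it is a leaf hanging from an interior vertex of P.
-- If |P| is odd, legs a, b at consecutive vertices Pᵢ, Pᵢ₊₁, followed by maximum matchings of the
-- two subpaths left after deleting Pᵢ, Pᵢ₊₁, would give mr⁻(T) ≥ |P| > mr⁻(P).

module Submission where

open import Defs hiding (sym; irrefl)
open import Level using (0ℓ)
open import Data.Nat as Nat using (ℕ; zero; suc; z≤n; s≤s; _≤_; _<_; _≤?_; _%_; ⌊_/2⌋)
import Data.Nat.Properties as ℕP
open import Data.Nat.DivMod using ([m+n]%n≡m%n)
open import Data.Fin as F using (Fin; zero; suc; toℕ; inject₁; fromℕ; fromℕ<; punchIn)
open import Data.Vec.Functional using (insertAt)
open import Data.Vec.Functional.Properties using (insertAt-lookup; insertAt-punchIn)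
import Data.Fin.Properties as FP
open import Data.Bool using (true)
import Data.Bool.Properties as BP
open import Data.Product using (Σ; ∃; ∃-syntax; _×_; _,_; proj₁; proj₂)
open import Data.Sum using (_⊎_; inj₁; inj₂)
open import Data.Empty using (⊥; ⊥-elim)
open import Data.Unit using (⊤; tt)
open import Data.List using (List; []; _∷_; length; _++_)
import Data.List.Properties as LP
open import Data.List.Relation.Unary.All as All using (All; []; _∷_)
import Data.List.Relation.Unary.All.Properties as AllP
open import Relation.Nullary using (¬_; Dec; yes; no; ¬?)
import Relation.Nullary.Decidable as Dec
open import Relation.Binary.PropositionalEquality
open import Function using (_∘_)
open import Relation.Binary.Structures using (IsStrictTotalOrder)
open import Relation.Binary.Definitions using (tri<; tri≈; tri>)
open import Algebra.Bundles using (CommutativeRing)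

module NatLemmas where
  open Nat using (_+_; _∸_)

  twice : ℕ → ℕ
  twice zero = zero
  twice (suc c) = suc (suc (twice c))

  twice-+ : ∀ a b → twice (a + b) ≡ twice a + twice b
  twice-+ zero b = refl
  twice-+ (suc a) b = cong (λ z → suc (suc z)) (twice-+ a b)

  twice-%2 : ∀ c → twice c % 2 ≡ 0
  twice-%2 zero = refl
  twice-%2 (suc c) = trans (cong (_% 2) (ℕP.+-comm 2 (twice c))) (trans ([m+n]%n≡m%n (twice c) 2) (twice-%2 c))

  twice⌊n/2⌋≤n : ∀ n → twice ⌊ n /2⌋ ≤ n
  twice⌊n/2⌋≤n zero = z≤n
  twice⌊n/2⌋≤n (suc zero) = z≤n
  twice⌊n/2⌋≤n (suc (suc n)) = s≤s (s≤s (twice⌊n/2⌋≤n n))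

  n≤1+twice⌊n/2⌋ : ∀ n → n ≤ suc (twice ⌊ n /2⌋)
  n≤1+twice⌊n/2⌋ zero = z≤n
  n≤1+twice⌊n/2⌋ (suc zero) = s≤s z≤n
  n≤1+twice⌊n/2⌋ (suc (suc n)) = s≤s (s≤s (n≤1+twice⌊n/2⌋ n))

  twice⌊n/2⌋-parity : ∀ n → n ≡ twice ⌊ n /2⌋ ⊎ n ≡ suc (twice ⌊ n /2⌋)
  twice⌊n/2⌋-parity zero = inj₁ refl
  twice⌊n/2⌋-parity (suc zero) = inj₂ refl
  twice⌊n/2⌋-parity (suc (suc n)) with twice⌊n/2⌋-parity n
  ... | inj₁ e = inj₁ (cong (λ z → suc (suc z)) e)
  ... | inj₂ e = inj₂ (cong (λ z → suc (suc z)) e)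

  odd⇒twice⌊1+n/2⌋≡n : ∀ n → suc n % 2 ≡ 1 → twice ⌊ suc n /2⌋ ≡ n
  odd⇒twice⌊1+n/2⌋≡n n odd with twice⌊n/2⌋-parity (suc n)
  ... | inj₁ e with () ← trans (sym (twice-%2 ⌊ suc n /2⌋)) (trans (cong (_% 2) (sym e)) odd)
  ... | inj₂ e = sym (ℕP.suc-injective e)

  L∸i≡1+L∸j⇒j≡1+i : ∀ {L i j} → i ≤ L → j ≤ L → L ∸ i ≡ suc (L ∸ j) → j ≡ suc i
  L∸i≡1+L∸j⇒j≡1+i {L} {i} {j} i≤L j≤L e = ℕP.+-cancelˡ-≡ (L ∸ j) j (suc i) (begin
    (L ∸ j) + j       ≡⟨ ℕP.m∸n+n≡m j≤L ⟩
    L                 ≡⟨ sym (ℕP.m∸n+n≡m i≤L) ⟩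
    (L ∸ i) + i       ≡⟨ cong (_+ i) e ⟩
    suc (L ∸ j) + i   ≡⟨ sym (ℕP.+-suc (L ∸ j) i) ⟩
    (L ∸ j) + suc i   ∎)
    where open ≡-Reasoning

  clamp : (k : ℕ) → ℕ → Fin (suc k)
  clamp k zero = zero
  clamp zero (suc j) = zero
  clamp (suc k) (suc j) = suc (clamp k j)

  toℕ-clamp : ∀ k j → j ≤ k → toℕ (clamp k j) ≡ j
  toℕ-clamp k zero _ = refl
  toℕ-clamp (suc k) (suc j) (s≤s le) = cong suc (toℕ-clamp k j le)

  clamp-toℕ : ∀ k (i : Fin (suc k)) → clamp k (toℕ i) ≡ i
  clamp-toℕ k zero = refl
  clamp-toℕ (suc k) (suc i) = cong suc (clamp-toℕ k i)

  clamp-fromℕ : ∀ k → clamp k k ≡ fromℕ k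
  clamp-fromℕ zero = refl
  clamp-fromℕ (suc k) = cong suc (clamp-fromℕ k)

  data Split (t : ℕ) : ℕ → Set where
    ≤-part : ∀ {j} → j ≤ t → Split t j
    >-part : ∀ u → Split t (suc t + u)

  split : ∀ t j → Split t j
  split t j with j ≤? t
  ... | yes le = ≤-part le
  ... | no nle = subst (Split t) (ℕP.m+[n∸m]≡n (ℕP.≰⇒> nle)) (>-part (j ∸ suc t))

  firstHit : {P : ℕ → Set} → (∀ i → Dec (P i)) → ∀ d m → ¬ P m → P (m + d) →
             ∃ λ s → m < s × s ≤ m + d × P s × (∀ j → m ≤ j → j < s → ¬ P j)
  firstHit {P} P? zero m ¬Pm Pm+0 = ⊥-elim (¬Pm (subst P (ℕP.+-identityʳ m) Pm+0))
  firstHit {P} P? (suc d) m ¬Pm Pm+d with P? (suc m)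
  ... | yes P1+m = suc m , ℕP.≤-refl , subst (suc m ≤_) (sym (ℕP.+-suc m d)) (s≤s (ℕP.m≤m+n m d)) , P1+m ,
                   λ j m≤j j<1+m → subst (λ z → ¬ P z) (ℕP.≤-antisym m≤j (ℕP.≤-pred j<1+m)) ¬Pm
  ... | no ¬P1+m with firstHit P? d (suc m) ¬P1+m (subst P (ℕP.+-suc m d) Pm+d)
  ...   | s , lt , le , Ps , before = s , ℕP.<-trans ℕP.≤-refl lt , subst (s ≤_) (sym (ℕP.+-suc m d)) le , Ps , before′
    where
    before′ : ∀ j → m ≤ j → j < s → ¬ P j
    before′ j m≤j j<s with ℕP.m≤n⇒m<n∨m≡n m≤j
    ... | inj₁ m<j = before j m<j j<s
    ... | inj₂ refl = ¬Pm

open NatLemmas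

-- Paths in graphs

module PathsIn {n : ℕ} (G : Graph n) where
  open Nat using (_+_; _∸_)

  Edge-sym : ∀ {u v} → Edge G u v → Edge G v u
  Edge-sym {u} {v} e = trans (Graph.sym G v u) e

  ¬Edge-refl : ∀ {v} → ¬ Edge G v v
  ¬Edge-refl {v} e with () ← trans (sym e) (Graph.irrefl G v)

  -- Only the values at 0, …, L matter; indexing by ℕ keeps the index arithmetic out of Fin.
  IsPathℕ : ℕ → (ℕ → Fin n) → Set
  IsPathℕ L f = (∀ i j → i ≤ L → j ≤ L → f i ≡ f j → i ≡ j) × (∀ i → i < L → Edge G (f i) (f (suc i)))

  IsInducedℕ : ℕ → (ℕ → Fin n) → Set
  IsInducedℕ L f = ∀ i j → i ≤ L → j ≤ L → Edge G (f i) (f j) → i ≡ suc j ⊎ j ≡ suc i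

  OnPathℕ : ℕ → (ℕ → Fin n) → Fin n → Set
  OnPathℕ K R v = ∃ λ i → i ≤ K × R i ≡ v

  onPathℕ? : ∀ K R v → Dec (OnPathℕ K R v)
  onPathℕ? K R v = Dec.map′ (λ { (i , s≤s i≤K , e) → i , i≤K , e }) (λ { (i , i≤K , e) → i , s≤s i≤K , e })
                            (Nat.anyUpTo? (λ i → R i F.≟ v) (suc K))

  Avoids : ℕ → (ℕ → Fin n) → ℕ → (ℕ → Fin n) → Set
  Avoids K R t e = ∀ j i → j ≤ t → i ≤ K → e j ≢ R i

  IsPathℕ⇒IsPath : ∀ {L f} → IsPathℕ L f → IsPath G L (λ i → f (toℕ i))
  IsPathℕ⇒IsPath {L} {f} (inj , edge) =
    (λ {i} {j} e → FP.toℕ-injective (inj (toℕ i) (toℕ j) (ℕP.≤-pred (FP.toℕ<n i)) (ℕP.≤-pred (FP.toℕ<n j)) e)) ,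
    λ i → subst (λ z → Edge G (f z) (f (suc (toℕ i)))) (sym (FP.toℕ-inject₁ i)) (edge (toℕ i) (FP.toℕ<n i))

  IsPath⇒IsPathℕ : ∀ {k p} → IsPath G k p → IsPathℕ k (λ j → p (clamp k j))
  IsPath⇒IsPathℕ {k} {p} (inj , edge) = inj′ , edge′
    where
    inj′ : ∀ i j → i ≤ k → j ≤ k → p (clamp k i) ≡ p (clamp k j) → i ≡ j
    inj′ i j i≤k j≤k e = trans (sym (toℕ-clamp k i i≤k)) (trans (cong toℕ (inj e)) (toℕ-clamp k j j≤k))
    edge′ : ∀ i → i < k → Edge G (p (clamp k i)) (p (clamp k (suc i)))
    edge′ i i<k = subst₂ (λ a b → Edge G (p a) (p b)) inject₁≡ suc≡ (edge (fromℕ< i<k))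
      where
      inject₁≡ : inject₁ (fromℕ< i<k) ≡ clamp k i
      inject₁≡ = FP.toℕ-injective (trans (FP.toℕ-inject₁ _)
                   (trans (FP.toℕ-fromℕ< i<k) (sym (toℕ-clamp k i (ℕP.<⇒≤ i<k)))))
      suc≡ : suc (fromℕ< i<k) ≡ clamp k (suc i)
      suc≡ = FP.toℕ-injective (trans (cong suc (FP.toℕ-fromℕ< i<k)) (sym (toℕ-clamp k (suc i) i<k)))

  IsInduced⇒IsInducedℕ : ∀ {k p} → IsInduced G k p → IsInducedℕ k (λ j → p (clamp k j))
  IsInduced⇒IsInducedℕ {k} {p} ind i j i≤k j≤k e =
    subst₂ (λ a b → a ≡ suc b ⊎ b ≡ suc a) (toℕ-clamp k i i≤k) (toℕ-clamp k j j≤k) (ind (clamp k i) (clamp k j) e)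

  reverseℕ : ℕ → (ℕ → Fin n) → ℕ → Fin n
  reverseℕ L f j = f (L ∸ j)

  reverse-IsPathℕ : ∀ {L f} → IsPathℕ L f → IsPathℕ L (reverseℕ L f)
  reverse-IsPathℕ {L} {f} (inj , edge) = inj′ , edge′
    where
    inj′ : ∀ i j → i ≤ L → j ≤ L → f (L ∸ i) ≡ f (L ∸ j) → i ≡ j
    inj′ i j i≤L j≤L e = ℕP.∸-cancelˡ-≡ i≤L j≤L (inj (L ∸ i) (L ∸ j) (ℕP.m∸n≤m L i) (ℕP.m∸n≤m L j) e)
    edge′ : ∀ i → i < L → Edge G (f (L ∸ i)) (f (L ∸ suc i))
    edge′ i i<L = subst (λ z → Edge G (f z) (f (L ∸ suc i))) (sym (ℕP.+-∸-assoc 1 i<L))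
                    (Edge-sym (edge (L ∸ suc i) (ℕP.∸-monoʳ-< {o = 0} (s≤s z≤n) i<L)))

  reverse-IsInducedℕ : ∀ {L f} → IsInducedℕ L f → IsInducedℕ L (reverseℕ L f)
  reverse-IsInducedℕ {L} {f} ind i j i≤L j≤L e with ind (L ∸ i) (L ∸ j) (ℕP.m∸n≤m L i) (ℕP.m∸n≤m L j) e
  ... | inj₁ e′ = inj₂ (L∸i≡1+L∸j⇒j≡1+i i≤L j≤L e′)
  ... | inj₂ e′ = inj₁ (L∸i≡1+L∸j⇒j≡1+i j≤L i≤L e′)

  shift-IsPathℕ : ∀ {L f} a L′ → a + L′ ≤ L → IsPathℕ L f → IsPathℕ L′ (λ j → f (a + j))
  shift-IsPathℕ {L} {f} a L′ a+L′≤L (inj , edge) = inj′ , edge′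
    where
    within : ∀ {i} → i ≤ L′ → a + i ≤ L
    within i≤L′ = ℕP.≤-trans (ℕP.+-monoʳ-≤ a i≤L′) a+L′≤L
    inj′ : ∀ i j → i ≤ L′ → j ≤ L′ → f (a + i) ≡ f (a + j) → i ≡ j
    inj′ i j i≤L′ j≤L′ e = ℕP.+-cancelˡ-≡ a i j (inj (a + i) (a + j) (within i≤L′) (within j≤L′) e)
    edge′ : ∀ i → i < L′ → Edge G (f (a + i)) (f (a + suc i))
    edge′ i i<L′ = subst (λ z → Edge G (f (a + i)) (f z)) (sym (ℕP.+-suc a i))
                     (edge (a + i) (ℕP.<-≤-trans (ℕP.+-monoʳ-< a i<L′) a+L′≤L))

  vertexPath : ∀ v → IsPathℕ 0 (λ _ → v)
  vertexPath v = (λ { zero zero _ _ _ → refl }) , λ i ()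

  pair : Fin n → Fin n → ℕ → Fin n
  pair x y zero = x
  pair x y (suc _) = y

  edgePath : ∀ {x y} → Edge G x y → IsPathℕ 1 (pair x y)
  edgePath {x} {y} exy = inj , edge
    where
    inj : ∀ i j → i ≤ 1 → j ≤ 1 → pair x y i ≡ pair x y j → i ≡ j
    inj zero zero _ _ _ = refl
    inj zero (suc zero) _ _ x≡y = ⊥-elim (¬Edge-refl (subst (Edge G x) (sym x≡y) exy))
    inj (suc zero) zero _ _ y≡x = ⊥-elim (¬Edge-refl (subst (Edge G x) y≡x exy))
    inj (suc zero) (suc zero) _ _ _ = refl
    inj zero (suc (suc j)) _ (s≤s ()) _
    inj (suc (suc i)) _ (s≤s ()) _ _
    inj (suc zero) (suc (suc j)) _ (s≤s ()) _
    edge : ∀ i → i < 1 → Edge G (pair x y i) (pair x y (suc i))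
    edge zero _ = exy
    edge (suc i) (s≤s ())

  glue : ℕ → (ℕ → Fin n) → (ℕ → Fin n) → ℕ → Fin n
  glue t e f j with j ≤? t
  ... | yes _ = e j
  ... | no _ = f (j ∸ suc t)

  glue-≤ : ∀ {t j} e f → j ≤ t → glue t e f j ≡ e j
  glue-≤ {t} {j} e f j≤t with j ≤? t
  ... | yes _ = refl
  ... | no j≰t = ⊥-elim (j≰t j≤t)

  glue-> : ∀ t e f u → glue t e f (suc t + u) ≡ f u
  glue-> t e f u with suc t + u ≤? t
  ... | yes le = ⊥-elim (ℕP.<-irrefl refl (ℕP.<-≤-trans (s≤s (ℕP.m≤m+n t u)) le))
  ... | no _ = cong f (ℕP.m+n∸m≡n (suc t) u)

  glue-IsPathℕ : ∀ {t e d f} → IsPathℕ t e → IsPathℕ d f → Avoids d f t e → Edge G (e t) (f 0) →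
                 IsPathℕ (suc t + d) (glue t e f)
  glue-IsPathℕ {t} {e} {d} {f} (inj-e , edge-e) (inj-f , edge-f) avoid et-f0 = inj , edge
    where
    u≤d : ∀ {u} → suc t + u ≤ suc t + d → u ≤ d
    u≤d = ℕP.+-cancelˡ-≤ (suc t) _ d
    inj : ∀ i j → i ≤ suc t + d → j ≤ suc t + d → glue t e f i ≡ glue t e f j → i ≡ j
    inj i j i≤ j≤ eq with split t i | split t j
    ... | ≤-part i≤t | ≤-part j≤t = inj-e i j i≤t j≤t (trans (sym (glue-≤ e f i≤t)) (trans eq (glue-≤ e f j≤t)))
    ... | ≤-part i≤t | >-part u = ⊥-elim (avoid i u i≤t (u≤d j≤) (trans (sym (glue-≤ e f i≤t)) (trans eq (glue-> t e f u))))
    ... | >-part u | ≤-part j≤t = ⊥-elim (avoid j u j≤t (u≤d i≤) (trans (sym (glue-≤ e f j≤t)) (trans (sym eq) (glue-> t e f u))))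
    ... | >-part u | >-part u′ =
      cong (suc t +_) (inj-f u u′ (u≤d i≤) (u≤d j≤) (trans (sym (glue-> t e f u)) (trans eq (glue-> t e f u′))))
    edge : ∀ i → i < suc t + d → Edge G (glue t e f i) (glue t e f (suc i))
    edge i i< with split t i
    ... | >-part u = subst₂ (Edge G) (sym (glue-> t e f u)) (sym (trans (cong (glue t e f) (sym (ℕP.+-suc (suc t) u))) (glue-> t e f (suc u))))
                       (edge-f u (ℕP.+-cancelˡ-< (suc t) u d i<))
    ... | ≤-part i≤t with ℕP.m≤n⇒m<n∨m≡n i≤t
    ...   | inj₁ i<t = subst₂ (Edge G) (sym (glue-≤ e f i≤t)) (sym (glue-≤ e f i<t)) (edge-e i i<t)
    ...   | inj₂ refl = subst₂ (Edge G) (sym (glue-≤ e f i≤t))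
                          (sym (trans (cong (glue t e f) (sym (ℕP.+-identityʳ (suc t)))) (glue-> t e f 0))) et-f0

  _◃_ : Fin n → (ℕ → Fin n) → ℕ → Fin n
  (v ◃ R) zero = v
  (v ◃ R) (suc j) = R j

  ◃-IsPathℕ : ∀ {K R v} → IsPathℕ K R → ¬ OnPathℕ K R v → Edge G v (R 0) → IsPathℕ (suc K) (v ◃ R)
  ◃-IsPathℕ {K} {R} {v} (inj , edge) off v-R0 = inj′ , edge′
    where
    inj′ : ∀ i j → i ≤ suc K → j ≤ suc K → (v ◃ R) i ≡ (v ◃ R) j → i ≡ j
    inj′ zero zero _ _ _ = refl
    inj′ zero (suc j) _ j≤ eq = ⊥-elim (off (j , ℕP.≤-pred j≤ , sym eq))
    inj′ (suc i) zero i≤ _ eq = ⊥-elim (off (i , ℕP.≤-pred i≤ , eq))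
    inj′ (suc i) (suc j) i≤ j≤ eq = cong suc (inj i j (ℕP.≤-pred i≤) (ℕP.≤-pred j≤) eq)
    edge′ : ∀ i → i < suc K → Edge G ((v ◃ R) i) ((v ◃ R) (suc i))
    edge′ zero _ = v-R0
    edge′ (suc i) i< = edge i (ℕP.≤-pred i<)

  ◃-IsInducedℕ : ∀ {K R v} → IsPathℕ K R → IsInducedℕ K R → (∀ w → Edge G v w → w ≡ R 0) →
                 IsInducedℕ (suc K) (v ◃ R)
  ◃-IsInducedℕ {K} {R} {v} (inj , _) ind pendant = ind′
    where
    ind′ : IsInducedℕ (suc K) (v ◃ R)
    ind′ zero zero _ _ e = ⊥-elim (¬Edge-refl e)
    ind′ zero (suc j) _ j≤ e = inj₂ (cong suc (inj j 0 (ℕP.≤-pred j≤) z≤n (pendant (R j) e)))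
    ind′ (suc i) zero i≤ _ e = inj₁ (cong suc (inj i 0 (ℕP.≤-pred i≤) z≤n (pendant (R i) (Edge-sym e))))
    ind′ (suc i) (suc j) i≤ j≤ e with ind i j (ℕP.≤-pred i≤) (ℕP.≤-pred j≤) e
    ... | inj₁ i≡1+j = inj₁ (cong suc i≡1+j)
    ... | inj₂ j≡1+i = inj₂ (cong suc j≡1+i)

  module InAcyclic (acyclic : Acyclic G) where

    noEar-ordered : ∀ {K R t e} → IsPathℕ K R → IsPathℕ t e → Avoids K R t e → ∀ b d → b + d ≤ K →
                    Edge G (e 0) (R (b + d)) → Edge G (e t) (R b) → 1 ≤ d ⊎ 1 ≤ t → ⊥
    noEar-ordered {K} {R} {t} {e} pathR pathe avoid b d b+d≤K e0-Rb+d et-Rb long =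
      acyclic (suc t + d , (λ i → cycle (toℕ i)) , 2≤ long , IsPathℕ⇒IsPath cycle-IsPathℕ , closing)
      where
      f : ℕ → Fin n
      f u = R (b + u)
      cycle : ℕ → Fin n
      cycle = glue t e f
      2≤ : 1 ≤ d ⊎ 1 ≤ t → 2 ≤ suc t + d
      2≤ (inj₁ 1≤d) = s≤s (ℕP.≤-trans 1≤d (ℕP.m≤n+m d t))
      2≤ (inj₂ 1≤t) = s≤s (ℕP.≤-trans 1≤t (ℕP.m≤m+n t d))
      avoid′ : Avoids d f t e
      avoid′ j u j≤t u≤d = avoid j (b + u) j≤t (ℕP.≤-trans (ℕP.+-monoʳ-≤ b u≤d) b+d≤K)
      cycle-IsPathℕ : IsPathℕ (suc t + d) cycle
      cycle-IsPathℕ = glue-IsPathℕ pathe (shift-IsPathℕ b d b+d≤K pathR) avoid′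
                        (subst (λ z → Edge G (e t) (R z)) (sym (ℕP.+-identityʳ b)) et-Rb)
      closing : Edge G (cycle (toℕ (fromℕ (suc t + d)))) (cycle 0)
      closing = subst₂ (Edge G) (sym (trans (cong cycle (FP.toℕ-fromℕ (suc t + d))) (glue-> t e f d)))
                  (sym (glue-≤ {t} e f z≤n)) (Edge-sym e0-Rb+d)

    -- e is an ear of R: together with the segment of R between R a and R b it would close a cycle.
    noEar : ∀ {K R t e} → IsPathℕ K R → IsPathℕ t e → Avoids K R t e → ∀ a b → a ≤ K → b ≤ K →
            Edge G (e 0) (R a) → Edge G (e t) (R b) → a ≢ b ⊎ 1 ≤ t → ⊥
    noEar {K} {R} {t} {e} pathR pathe avoid a b a≤K b≤K e0-Ra et-Rb long with b ≤? a
    ... | yes b≤a = noEar-ordered pathR pathe avoid b (a ∸ b) (subst (_≤ K) (sym b+[a∸b]≡a) a≤K)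
                      (subst (λ z → Edge G (e 0) (R z)) (sym b+[a∸b]≡a) e0-Ra) et-Rb (long′ long)
      where
      b+[a∸b]≡a : b + (a ∸ b) ≡ a
      b+[a∸b]≡a = ℕP.m+[n∸m]≡n b≤a
      long′ : a ≢ b ⊎ 1 ≤ t → 1 ≤ a ∸ b ⊎ 1 ≤ t
      long′ (inj₂ 1≤t) = inj₂ 1≤t
      long′ (inj₁ a≢b) = inj₁ (ℕP.m<n⇒0<n∸m (ℕP.≤∧≢⇒< b≤a (λ b≡a → a≢b (sym b≡a))))
    ... | no b≰a = noEar-ordered pathR (reverse-IsPathℕ pathe) avoid′ a (b ∸ a) (subst (_≤ K) (sym a+[b∸a]≡b) b≤K)
                     (subst (λ z → Edge G (e t) (R z)) (sym a+[b∸a]≡b) et-Rb)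
                     (subst (λ z → Edge G (e z) (R a)) (sym (ℕP.n∸n≡0 t)) e0-Ra) (inj₁ (ℕP.m<n⇒0<n∸m a<b))
      where
      a<b : a < b
      a<b = ℕP.≰⇒> b≰a
      a+[b∸a]≡b : a + (b ∸ a) ≡ b
      a+[b∸a]≡b = ℕP.m+[n∸m]≡n (ℕP.<⇒≤ a<b)
      avoid′ : Avoids K R t (reverseℕ t e)
      avoid′ j i j≤t i≤K = avoid (t ∸ j) i (ℕP.m∸n≤m t j) i≤K

    noReentry : ∀ {K R L q} → IsPathℕ K R → IsPathℕ L q → ∀ t a → t < L → a ≤ K → q t ≡ R a →
                ¬ OnPathℕ K R (q (suc t)) → OnPathℕ K R (q L) → ⊥
    noReentry {K} {R} {L} {q} pathR pathq@(inj-q , edge-q) t a t<L a≤K qt≡Ra off onL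
      with firstHit (λ i → onPathℕ? K R (q i)) (L ∸ suc t) (suc t) off
             (subst (λ z → OnPathℕ K R (q z)) (sym (ℕP.m+[n∸m]≡n t<L)) onL)
    ... | s , 1+t<s , s≤ , (m , m≤K , Rm≡qs) , before =
      noEar pathR (shift-IsPathℕ (suc t) w w-bound pathq) avoid a m a≤K m≤K first last (inj₁ a≢m)
      where
      s≤L : s ≤ L
      s≤L = subst (s ≤_) (ℕP.m+[n∸m]≡n t<L) s≤
      w = s ∸ suc (suc t)
      2+t+w≡s : suc (suc t) + w ≡ s
      2+t+w≡s = ℕP.m+[n∸m]≡n 1+t<s
      w-bound : suc t + w ≤ L
      w-bound = ℕP.≤-trans (ℕP.n≤1+n _) (subst (_≤ L) (sym 2+t+w≡s) s≤L)
      avoid : Avoids K R w (λ j → q (suc t + j))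
      avoid j i j≤w i≤K eq = before (suc t + j) (ℕP.m≤m+n (suc t) j)
                               (subst (suc t + j <_) 2+t+w≡s (s≤s (ℕP.+-monoʳ-≤ (suc t) j≤w))) (i , i≤K , sym eq)
      first : Edge G (q (suc t + 0)) (R a)
      first = subst₂ (λ x y → Edge G (q x) y) (sym (ℕP.+-identityʳ (suc t))) qt≡Ra (Edge-sym (edge-q t t<L))
      last : Edge G (q (suc t + w)) (R m)
      last = subst (Edge G (q (suc t + w))) (trans (cong q 2+t+w≡s) (sym Rm≡qs))
               (edge-q (suc t + w) (subst (_≤ L) (sym 2+t+w≡s) s≤L))
      a≢m : a ≢ m
      a≢m refl = ℕP.<⇒≢ (ℕP.<-trans (ℕP.n<1+n t) 1+t<s)
                   (inj-q t s (ℕP.<⇒≤ t<L) s≤L (trans qt≡Ra Rm≡qs))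

    induced-next : ∀ {K R L q} → IsPathℕ K R → IsInducedℕ K R → IsPathℕ L q → q L ≡ R K →
                   ∀ t → suc t ≤ L → t < K → (∀ t′ → t′ ≤ t → q t′ ≡ R t′) → q (suc t) ≡ R (suc t)
    induced-next {K} {R} {L} {q} pathR ind pathq@(inj-q , edge-q) qL≡RK t 1+t≤L t<K agree
      with onPathℕ? K R (q (suc t))
    ... | no off = ⊥-elim (noReentry pathR pathq t t 1+t≤L (ℕP.<⇒≤ t<K) (agree t ℕP.≤-refl) off
                                      (K , ℕP.≤-refl , sym qL≡RK))
    ... | yes (m , m≤K , Rm≡) with ind t m (ℕP.<⇒≤ t<K) m≤K (subst₂ (Edge G) (agree t ℕP.≤-refl) (sym Rm≡) (edge-q t 1+t≤L))
    ...   | inj₂ refl = sym Rm≡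
    ...   | inj₁ refl = ⊥-elim (ℕP.<⇒≢ (ℕP.≤-trans (ℕP.n<1+n m) (ℕP.n≤1+n _)) (sym 2+m≡m))
      where
      2+m≡m : suc (suc m) ≡ m
      2+m≡m = inj-q (suc (suc m)) m 1+t≤L (ℕP.≤-trans (ℕP.n≤1+n m) (ℕP.<⇒≤ 1+t≤L))
                (trans (sym Rm≡) (sym (agree m (ℕP.n≤1+n m))))

    induced-shortest : ∀ {K R L q} → IsPathℕ K R → IsInducedℕ K R → IsPathℕ L q → q 0 ≡ R 0 → q L ≡ R K → K ≤ L
    induced-shortest {K} {R} {L} {q} pathR ind pathq q0≡R0 qL≡RK with K ≤? L
    ... | yes K≤L = K≤L
    ... | no K≰L = ⊥-elim (ℕP.<⇒≢ L<K (proj₁ pathR L K (ℕP.<⇒≤ L<K) ℕP.≤-refl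
                                        (trans (sym (agree L ℕP.≤-refl L ℕP.≤-refl)) qL≡RK)))
      where
      L<K : L < K
      L<K = ℕP.≰⇒> K≰L
      agree : ∀ t → t ≤ L → ∀ t′ → t′ ≤ t → q t′ ≡ R t′
      agree zero _ zero _ = q0≡R0
      agree (suc t) 1+t≤L t′ t′≤1+t with ℕP.m≤n⇒m<n∨m≡n t′≤1+t
      ... | inj₁ t′<1+t = agree t (ℕP.<⇒≤ 1+t≤L) t′ (ℕP.≤-pred t′<1+t)
      ... | inj₂ refl = induced-next pathR ind pathq qL≡RK t 1+t≤L (ℕP.<-trans 1+t≤L L<K) (agree t (ℕP.<⇒≤ 1+t≤L))

    noPendantAtStart : ∀ {K R v} → (∀ u w e → Dist G u w e → e ≤ K) → IsPathℕ K R → IsInducedℕ K R →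
                       ¬ OnPathℕ K R v → Edge G v (R 0) → (∀ w → Edge G v w → w ≡ R 0) → ⊥
    noPendantAtStart {K} {R} {v} diameter pathR ind off v-R0 pendant =
      ℕP.<-irrefl refl (diameter v (R K) (suc K) (longer , shortest))
      where
      path : IsPathℕ (suc K) (v ◃ R)
      path = ◃-IsPathℕ pathR off v-R0
      longer : ∃[ p ] PathFromTo G (suc K) v (R K) p
      longer = (λ i → (v ◃ R) (toℕ i)) , IsPathℕ⇒IsPath path , refl , cong (v ◃ R) (FP.toℕ-fromℕ (suc K))
      shortest : ∀ k p → PathFromTo G k v (R K) p → suc K ≤ k
      shortest k p (path-p , p0≡v , pk≡RK) =
        induced-shortest path (◃-IsInducedℕ pathR ind pendant) (IsPath⇒IsPathℕ path-p) p0≡v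
          (trans (cong p (clamp-fromℕ k)) pk≡RK)

    attached-unique : ∀ {K R v a b} → IsPathℕ K R → ¬ OnPathℕ K R v → a ≤ K → b ≤ K →
                      Edge G v (R a) → Edge G v (R b) → a ≡ b
    attached-unique {v = v} {a} {b} pathR off a≤K b≤K v-Ra v-Rb with a Nat.≟ b
    ... | yes a≡b = a≡b
    ... | no a≢b = ⊥-elim (noEar pathR (vertexPath v) (λ _ i _ i≤K e → off (i , i≤K , sym e)) a b a≤K b≤K v-Ra v-Rb (inj₁ a≢b))

    ¬attachedEdge : ∀ {K R x y a b} → IsPathℕ K R → ¬ OnPathℕ K R x → ¬ OnPathℕ K R y → a ≤ K → b ≤ K →
                    Edge G x y → Edge G x (R a) → Edge G y (R b) → ⊥
    ¬attachedEdge pathR x-off y-off a≤K b≤K x-y x-Ra y-Rb =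
      noEar pathR (edgePath x-y) avoid _ _ a≤K b≤K x-Ra y-Rb (inj₂ ℕP.≤-refl)
      where
      avoid : Avoids _ _ 1 (pair _ _)
      avoid zero i _ i≤K e = x-off (i , i≤K , sym e)
      avoid (suc zero) i _ i≤K e = y-off (i , i≤K , sym e)
      avoid (suc (suc _)) _ (s≤s ()) _


-- Linear algebra over the reals

module LinearAlgebra (R : RealNumbers) where
  open RealNumbers R
  open SkewRank R using (sumFin; Matrix)

  commutativeRing : CommutativeRing 0ℓ 0ℓ
  commutativeRing = record { isCommutativeRing = isCommutativeRing }

  open CommutativeRing commutativeRing public
    using (+-comm; +-identityˡ; +-identityʳ; -‿inverseˡ; -‿inverseʳ;
           *-assoc; *-comm; *-identityˡ; *-identityʳ; distribʳ; zeroˡ; zeroʳ; ring; +-commutativeMonoid; semiring)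
  open import Algebra.Properties.Ring ring public using (-‿distribˡ-*; -‿distribʳ-*; -‿involutive; -0#≈0#; -‿+-comm; +-inverseʳ-unique)
  open import Algebra.Properties.CommutativeMonoid.Sum +-commutativeMonoid public
    using (sum; sum-syntax; sum-cong-≗; sum-replicate-zero; ∑-distrib-+; ∑-comm; sum-remove)
  open import Algebra.Properties.Semiring.Sum semiring public using (*-distribˡ-sum; *-distribʳ-sum)
  open IsStrictTotalOrder isStrictTotalOrder public using (compare)
    renaming (_≟_ to _≟ℝ_; trans to <-trans; irrefl to <-irrefl)
  open ≡-Reasoning

  0<1 : 0ℝ <ℝ 1ℝ
  0<1 with compare 0ℝ 1ℝ
  ... | tri< 0<1 _ _ = 0<1
  ... | tri≈ _ 0≡1 _ = ⊥-elim (nontrivial 0≡1)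
  ... | tri> _ _ 1<0 = ⊥-elim (<-irrefl refl (<-trans 1<0 0<1′))
    where
    0<-1 : 0ℝ <ℝ - 1ℝ
    0<-1 = subst₂ _<ℝ_ (-‿inverseʳ 1ℝ) (+-identityˡ (- 1ℝ)) (+-mono-< 1ℝ 0ℝ (- 1ℝ) 1<0)
    0<1′ : 0ℝ <ℝ 1ℝ
    0<1′ = subst (0ℝ <ℝ_) (begin
      - 1ℝ * - 1ℝ      ≡⟨ sym (-‿distribˡ-* 1ℝ (- 1ℝ)) ⟩
      - (1ℝ * - 1ℝ)    ≡⟨ cong -_ (*-identityˡ (- 1ℝ)) ⟩
      - (- 1ℝ)         ≡⟨ -‿involutive 1ℝ ⟩
      1ℝ               ∎) (*-pos (- 1ℝ) (- 1ℝ) 0<-1 0<-1)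

  1≢0 : 1ℝ ≢ 0ℝ
  1≢0 1≡0 = nontrivial (sym 1≡0)

  2≢0 : 1ℝ + 1ℝ ≢ 0ℝ
  2≢0 2≡0 = <-irrefl (sym 2≡0) (<-trans 0<1 (subst (_<ℝ 1ℝ + 1ℝ) (+-identityˡ 1ℝ) (+-mono-< 0ℝ 1ℝ 1ℝ 0<1)))

  x≢0∧x*y≡0⇒y≡0 : ∀ {x y} → x ≢ 0ℝ → x * y ≡ 0ℝ → y ≡ 0ℝ
  x≢0∧x*y≡0⇒y≡0 {x} {y} x≢0 x*y≡0 with inverse x x≢0
  ... | x⁻¹ , x*x⁻¹≡1 = begin
    y                 ≡⟨ sym (*-identityˡ y) ⟩
    1ℝ * y            ≡⟨ cong (_* y) (trans (sym x*x⁻¹≡1) (*-comm x x⁻¹)) ⟩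
    (x⁻¹ * x) * y     ≡⟨ *-assoc x⁻¹ x y ⟩
    x⁻¹ * (x * y)     ≡⟨ cong (x⁻¹ *_) x*y≡0 ⟩
    x⁻¹ * 0ℝ          ≡⟨ zeroʳ x⁻¹ ⟩
    0ℝ                ∎

  -x≢0 : ∀ {x} → x ≢ 0ℝ → - x ≢ 0ℝ
  -x≢0 {x} x≢0 -x≡0 = x≢0 (trans (sym (-‿involutive x)) (trans (cong -_ -x≡0) -0#≈0#))

  x≡-x⇒x≡0 : ∀ {x} → x ≡ - x → x ≡ 0ℝ
  x≡-x⇒x≡0 {x} x≡-x = x≢0∧x*y≡0⇒y≡0 2≢0 (begin
    (1ℝ + 1ℝ) * x     ≡⟨ distribʳ x 1ℝ 1ℝ ⟩
    1ℝ * x + 1ℝ * x   ≡⟨ cong₂ _+_ (*-identityˡ x) (*-identityˡ x) ⟩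
    x + x             ≡⟨ cong (x +_) x≡-x ⟩
    x + - x           ≡⟨ -‿inverseʳ x ⟩
    0ℝ                ∎)

  x≡0⇒x*y≡0 : ∀ {x} y → x ≡ 0ℝ → x * y ≡ 0ℝ
  x≡0⇒x*y≡0 y refl = zeroˡ y

  y≡0⇒x*y≡0 : ∀ x {y} → y ≡ 0ℝ → x * y ≡ 0ℝ
  y≡0⇒x*y≡0 x refl = zeroʳ x

  sumFin≡sum : ∀ {r} (f : Fin r → ℝ) → sumFin f ≡ sum f
  sumFin≡sum {zero} f = refl
  sumFin≡sum {suc r} f = cong (f zero +_) (sumFin≡sum (λ i → f (suc i)))

  sum-zero : ∀ {r} {f : Fin r → ℝ} → (∀ i → f i ≡ 0ℝ) → sum f ≡ 0ℝ
  sum-zero {r} f≗0 = trans (sum-cong-≗ f≗0) (sum-replicate-zero r)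

  ∑-neg : ∀ {r} (f : Fin r → ℝ) → ∑[ i < r ] (- f i) ≡ - (∑[ i < r ] f i)
  ∑-neg {zero} f = sym -0#≈0#
  ∑-neg {suc r} f = trans (cong (- f zero +_) (∑-neg (λ i → f (suc i)))) (-‿+-comm (f zero) _)

  sum-single : ∀ {m} {f : Fin (suc m) → ℝ} j → (∀ t → t ≢ j → f t ≡ 0ℝ) → sum f ≡ f j
  sum-single {f = f} j others = begin
    sum f                             ≡⟨ sum-remove f ⟩
    f j + sum (λ u → f (punchIn j u)) ≡⟨ cong (f j +_) (sum-zero (λ u → others (punchIn j u) (FP.punchInᵢ≢i j u))) ⟩
    f j + 0ℝ                          ≡⟨ +-identityʳ (f j) ⟩
    f j                               ∎

  IsNullVector : ∀ {s m} → Matrix s m → (Fin m → ℝ) → Set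
  IsNullVector {s} {m} C y = ∀ l → ∑[ t < m ] (C l t * y t) ≡ 0ℝ

  HasNonzeroNullVector : ∀ {s m} → Matrix s m → Set
  HasNonzeroNullVector {m = m} C = Σ (Fin m → ℝ) λ y → (∃[ t ] y t ≢ 0ℝ) × IsNullVector C y

  nullVector-zeroRow : ∀ {s m} (C : Matrix (suc s) m) → (∀ t → C zero t ≡ 0ℝ) →
                       HasNonzeroNullVector (λ l → C (suc l)) → HasNonzeroNullVector C
  nullVector-zeroRow C zeroRow (y , nonzero , null) = y , nonzero , null′
    where
    null′ : IsNullVector C y
    null′ zero = sum-zero (λ t → x≡0⇒x*y≡0 (y t) (zeroRow t))
    null′ (suc l) = null l

  eliminate : ∀ {s m} → Matrix (suc s) (suc m) → Fin (suc m) → ℝ → Matrix s m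
  eliminate C j w l u = C (suc l) (punchIn j u) + - (C (suc l) j * w) * C zero (punchIn j u)

  nullVector-pivot : ∀ {s m} (C : Matrix (suc s) (suc m)) j w → C zero j * w ≡ 1ℝ →
                     HasNonzeroNullVector (eliminate C j w) → HasNonzeroNullVector C
  nullVector-pivot {s} {m} C j w pivot (y′ , (t , y′t≢0) , null) = y , (punchIn j t , y-punchIn≢0) , null′
    where
    Σ₀ : ℝ
    Σ₀ = ∑[ u < m ] (C zero (punchIn j u) * y′ u)
    y : Fin (suc m) → ℝ
    y = insertAt y′ j (- (w * Σ₀))
    y-punchIn≢0 : y (punchIn j t) ≢ 0ℝ
    y-punchIn≢0 e = y′t≢0 (trans (sym (insertAt-punchIn y′ j _ t)) e)
    row : ∀ l → ∑[ t < suc m ] (C l t * y t) ≡ C l j * - (w * Σ₀) + ∑[ u < m ] (C l (punchIn j u) * y′ u)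
    row l = trans (sum-remove (λ t → C l t * y t))
                  (cong₂ _+_ (cong (C l j *_) (insertAt-lookup y′ j _))
                             (sum-cong-≗ (λ u → cong (C l (punchIn j u) *_) (insertAt-punchIn y′ j _ u))))
    scale : ∀ x → x * - (w * Σ₀) ≡ - (x * w) * Σ₀
    scale x = begin
      x * - (w * Σ₀)     ≡⟨ sym (-‿distribʳ-* x (w * Σ₀)) ⟩
      - (x * (w * Σ₀))   ≡⟨ cong -_ (sym (*-assoc x w Σ₀)) ⟩
      - ((x * w) * Σ₀)   ≡⟨ -‿distribˡ-* (x * w) Σ₀ ⟩
      - (x * w) * Σ₀     ∎
    null′ : IsNullVector C y
    null′ zero = begin
      ∑[ t < suc m ] (C zero t * y t)   ≡⟨ row zero ⟩
      C zero j * - (w * Σ₀) + Σ₀        ≡⟨ cong (_+ Σ₀) (scale (C zero j)) ⟩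
      - (C zero j * w) * Σ₀ + Σ₀        ≡⟨ cong (λ z → - z * Σ₀ + Σ₀) pivot ⟩
      - 1ℝ * Σ₀ + Σ₀                    ≡⟨ cong (_+ Σ₀) (trans (sym (-‿distribˡ-* 1ℝ Σ₀)) (cong -_ (*-identityˡ Σ₀))) ⟩
      - Σ₀ + Σ₀                         ≡⟨ -‿inverseˡ Σ₀ ⟩
      0ℝ                                ∎
    null′ (suc l) = begin
      ∑[ t < suc m ] (C (suc l) t * y t)  ≡⟨ row (suc l) ⟩
      C (suc l) j * - (w * Σ₀) + Σ₁       ≡⟨ cong (_+ Σ₁) (scale (C (suc l) j)) ⟩
      λₗ * Σ₀ + Σ₁                        ≡⟨ +-comm (λₗ * Σ₀) Σ₁ ⟩
      Σ₁ + λₗ * Σ₀                        ≡⟨ cong (Σ₁ +_) (*-distribˡ-sum λₗ (λ u → C zero (punchIn j u) * y′ u)) ⟩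
      Σ₁ + ∑[ u < m ] (λₗ * (C zero (punchIn j u) * y′ u))
        ≡⟨ sym (∑-distrib-+ (λ u → C (suc l) (punchIn j u) * y′ u) _) ⟩
      ∑[ u < m ] (C (suc l) (punchIn j u) * y′ u + λₗ * (C zero (punchIn j u) * y′ u))
        ≡⟨ sum-cong-≗ (λ u → trans (cong (C (suc l) (punchIn j u) * y′ u +_) (sym (*-assoc λₗ _ (y′ u))))
                                   (sym (distribʳ (y′ u) _ _))) ⟩
      ∑[ u < m ] (eliminate C j w l u * y′ u) ≡⟨ null l ⟩
      0ℝ                                  ∎
      where
      λₗ = - (C (suc l) j * w)
      Σ₁ = ∑[ u < m ] (C (suc l) (punchIn j u) * y′ u)

  wide⇒nullVector : ∀ {s m} → s < m → (C : Matrix s m) → HasNonzeroNullVector C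
  wide⇒nullVector {zero} {suc m} _ C = (λ _ → 1ℝ) , (zero , 1≢0) , λ ()
  wide⇒nullVector {suc s} {suc m} (s≤s s<m) C with FP.any? (λ j → ¬? (C zero j ≟ℝ 0ℝ))
  ... | yes (j , Cj≢0) = nullVector-pivot C j (proj₁ (inverse _ Cj≢0)) (proj₂ (inverse _ Cj≢0))
                           (wide⇒nullVector s<m _)
  ... | no noPivot = nullVector-zeroRow C zeroRow (wide⇒nullVector (ℕP.m<n⇒m<1+n s<m) (λ l → C (suc l)))
    where
    zeroRow : ∀ t → C zero t ≡ 0ℝ
    zeroRow t = Dec.decidable-stable (C zero t ≟ℝ 0ℝ) (λ Ct≢0 → noPivot (t , Ct≢0))

  open SkewRank R using (RankAtMost)

  nonsingularMinor⇒rank≥ : ∀ {N d s} (A : Matrix N N) (σ : Fin d → Fin N) →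
                           (∀ y → IsNullVector (λ u t → A (σ u) (σ t)) y → ∀ t → y t ≡ 0ℝ) →
                           RankAtMost A s → d ≤ s
  nonsingularMinor⇒rank≥ {N} {d} {s} A σ nonsingular (B , C , A≡BC) with d ≤? s
  ... | yes d≤s = d≤s
  ... | no d≰s with wide⇒nullVector (ℕP.≰⇒> d≰s) (λ l t → C l (σ t))
  ...   | y , (t , yt≢0) , Cy≡0 = ⊥-elim (yt≢0 (nonsingular y Ay≡0 t))
    where
    Ay≡0 : IsNullVector (λ u t → A (σ u) (σ t)) y
    Ay≡0 u = begin
      ∑[ t < d ] (A (σ u) (σ t) * y t)
        ≡⟨ sum-cong-≗ (λ t → cong (_* y t) (trans (A≡BC (σ u) (σ t)) (sumFin≡sum (λ l → B (σ u) l * C l (σ t))))) ⟩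
      ∑[ t < d ] (∑[ l < s ] (B (σ u) l * C l (σ t)) * y t)
        ≡⟨ sum-cong-≗ (λ t → *-distribʳ-sum (y t) (λ l → B (σ u) l * C l (σ t))) ⟩
      ∑[ t < d ] ∑[ l < s ] ((B (σ u) l * C l (σ t)) * y t)
        ≡⟨ ∑-comm (λ t l → (B (σ u) l * C l (σ t)) * y t) ⟩
      ∑[ l < s ] ∑[ t < d ] ((B (σ u) l * C l (σ t)) * y t)
        ≡⟨ sum-cong-≗ (λ l → trans (sum-cong-≗ (λ t → *-assoc (B (σ u) l) (C l (σ t)) (y t)))
                                   (sym (*-distribˡ-sum (B (σ u) l) (λ t → C l (σ t) * y t)))) ⟩
      ∑[ l < s ] (B (σ u) l * ∑[ t < d ] (C l (σ t) * y t))
        ≡⟨ sum-zero (λ l → y≡0⇒x*y≡0 (B (σ u) l) (Cy≡0 l)) ⟩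
      0ℝ ∎

  δ : ∀ {m} → Fin m → Fin m → ℝ
  δ l j with l F.≟ j
  ... | yes _ = 1ℝ
  ... | no _ = 0ℝ

  ∑-δ : ∀ {m} (f : Fin m → ℝ) j → ∑[ l < m ] (f l * δ l j) ≡ f j
  ∑-δ {suc m} f j = trans (sum-single j off-diagonal) (trans (cong (f j *_) on-diagonal) (*-identityʳ (f j)))
    where
    off-diagonal : ∀ l → l ≢ j → f l * δ l j ≡ 0ℝ
    off-diagonal l l≢j with l F.≟ j
    ... | yes l≡j = ⊥-elim (l≢j l≡j)
    ... | no _ = zeroʳ (f l)
    on-diagonal : δ j j ≡ 1ℝ
    on-diagonal with j F.≟ j
    ... | yes _ = refl
    ... | no j≢j = ⊥-elim (j≢j refl)

  rank≤size : ∀ {m} (A : Matrix m m) → RankAtMost A m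
  rank≤size A = A , δ , λ i j → sym (trans (sumFin≡sum (λ l → A i l * δ l j)) (∑-δ (A i) j))

  -- Column 0 is a combination of the other columns, so A = B C with B the remaining columns.
  nullVector⇒rank≤ : ∀ {K} (A : Matrix (suc K) (suc K)) z → z zero ≢ 0ℝ → IsNullVector A z → RankAtMost A K
  nullVector⇒rank≤ {K} A z z₀≢0 null = B , C , λ i j → sym (trans (sumFin≡sum (λ l → B i l * C l j)) (column i j))
    where
    w = proj₁ (inverse (z zero) z₀≢0)
    B : Matrix (suc K) K
    B i l = A i (suc l)
    C : Matrix K (suc K)
    C l zero = - w * z (suc l)
    C l (suc j) = δ l j
    column : ∀ i j → ∑[ l < K ] (B i l * C l j) ≡ A i j
    column i (suc j) = ∑-δ (B i) j
    column i zero = begin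
      ∑[ l < K ] (A i (suc l) * (- w * z (suc l)))
        ≡⟨ sum-cong-≗ (λ l → trans (sym (*-assoc (A i (suc l)) (- w) _))
                         (trans (cong (_* z (suc l)) (*-comm (A i (suc l)) (- w))) (*-assoc (- w) _ _))) ⟩
      ∑[ l < K ] (- w * (A i (suc l) * z (suc l)))
        ≡⟨ sym (*-distribˡ-sum (- w) (λ l → A i (suc l) * z (suc l))) ⟩
      - w * ∑[ l < K ] (A i (suc l) * z (suc l))
        ≡⟨ cong (- w *_) (+-inverseʳ-unique (A i zero * z zero) _ (null i)) ⟩
      - w * - (A i zero * z zero)
        ≡⟨ trans (sym (-‿distribˡ-* w _)) (trans (cong -_ (sym (-‿distribʳ-* w _))) (-‿involutive _)) ⟩
      w * (A i zero * z zero)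
        ≡⟨ trans (*-comm w _) (*-assoc (A i zero) (z zero) w) ⟩
      A i zero * (z zero * w)
        ≡⟨ cong (A i zero *_) (proj₂ (inverse (z zero) z₀≢0)) ⟩
      A i zero * 1ℝ
        ≡⟨ *-identityʳ (A i zero) ⟩
      A i zero ∎

-- Triangular matchings

module Matchings {N : ℕ} (G : Graph N) where

  Pairs : Set
  Pairs = List (Fin N × Fin N)

  endpoints : Pairs → List (Fin N)
  endpoints [] = []
  endpoints ((x , y) ∷ ps) = x ∷ y ∷ endpoints ps

  vertex : (ps : Pairs) → Fin (twice (length ps)) → Fin N
  vertex ((x , y) ∷ ps) zero = x
  vertex ((x , y) ∷ ps) (suc zero) = y
  vertex ((x , y) ∷ ps) (suc (suc t)) = vertex ps t

  IsTriangular : Pairs → Set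
  IsTriangular [] = ⊤
  IsTriangular ((x , y) ∷ ps) = Edge G x y × All (λ z → ¬ Edge G x z) (endpoints ps) × IsTriangular ps

  All-vertex : ∀ {P : Fin N → Set} ps → All P (endpoints ps) → ∀ t → P (vertex ps t)
  All-vertex ((x , y) ∷ ps) (px ∷ py ∷ rest) zero = px
  All-vertex ((x , y) ∷ ps) (px ∷ py ∷ rest) (suc zero) = py
  All-vertex ((x , y) ∷ ps) (px ∷ py ∷ rest) (suc (suc t)) = All-vertex ps rest t

module SkewMatrices (R : RealNumbers) {N : ℕ} (G : Graph N)
                    (A : SkewRank.Matrix R N N) (A∈S⁻ : SkewRank.InSkew R G A) where
  open RealNumbers R
  open SkewRank R using (RankAtMost)
  open LinearAlgebra R
  open PathsIn G using (Edge-sym; ¬Edge-refl)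
  open Matchings G
  open ≡-Reasoning

  diagonal≡0 : ∀ i → A i i ≡ 0ℝ
  diagonal≡0 i = x≡-x⇒x≡0 (proj₁ A∈S⁻ i i)

  ¬Edge⇒≡0 : ∀ {i j} → ¬ Edge G i j → A i j ≡ 0ℝ
  ¬Edge⇒≡0 {i} {j} ¬edge with i F.≟ j
  ... | yes refl = diagonal≡0 i
  ... | no i≢j = Dec.decidable-stable (A i j ≟ℝ 0ℝ) (λ Aij≢0 → ¬edge (proj₁ (proj₂ A∈S⁻ i j i≢j) Aij≢0))

  Edge⇒≢0 : ∀ {i j} → Edge G i j → A i j ≢ 0ℝ
  Edge⇒≢0 {i} {j} edge = proj₂ (proj₂ A∈S⁻ i j i≢j) edge
    where
    i≢j : i ≢ j
    i≢j refl = ¬Edge-refl edge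

  triangular⇒nonsingular : ∀ ps → IsTriangular ps → (y : Fin (twice (length ps)) → ℝ) →
                           LinearAlgebra.IsNullVector R (λ u t → A (vertex ps u) (vertex ps t)) y → ∀ t → y t ≡ 0ℝ
  triangular⇒nonsingular ((x , x′) ∷ ps) (x-x′ , x≁ps , triangular) y null = y≡0
    where
    ρ = vertex ps
    x≁ρ : ∀ t → ¬ Edge G x (ρ t)
    x≁ρ = All-vertex ps x≁ps
    rowTail : Fin N → ℝ
    rowTail v = ∑[ t < twice (length ps) ] (A v (ρ t) * y (suc (suc t)))
    drop : ∀ {p} c → p ≡ 0ℝ → p + c ≡ c
    drop c p≡0 = trans (cong (_+ c) p≡0) (+-identityˡ c)
    y₁≡0 : y (suc zero) ≡ 0ℝ
    y₁≡0 = x≢0∧x*y≡0⇒y≡0 (Edge⇒≢0 x-x′) (begin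
      A x x′ * y (suc zero)                                 ≡⟨ sym (+-identityʳ _) ⟩
      A x x′ * y (suc zero) + 0ℝ                            ≡⟨ cong (A x x′ * y (suc zero) +_) (sym x-row-tail) ⟩
      A x x′ * y (suc zero) + rowTail x                        ≡⟨ sym (drop _ (x≡0⇒x*y≡0 (y zero) (diagonal≡0 x))) ⟩
      A x x * y zero + (A x x′ * y (suc zero) + rowTail x)     ≡⟨ null zero ⟩
      0ℝ                                                    ∎)
      where
      x-row-tail : rowTail x ≡ 0ℝ
      x-row-tail = sum-zero (λ t → x≡0⇒x*y≡0 _ (¬Edge⇒≡0 (x≁ρ t)))
    rest≡0 : ∀ t → y (suc (suc t)) ≡ 0ℝ
    rest≡0 = triangular⇒nonsingular ps triangular (λ t → y (suc (suc t))) λ u → begin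
      rowTail (ρ u)                                                     ≡⟨ sym (drop _ (y≡0⇒x*y≡0 (A (ρ u) x′) y₁≡0)) ⟩
      A (ρ u) x′ * y (suc zero) + rowTail (ρ u)
        ≡⟨ sym (drop _ (x≡0⇒x*y≡0 (y zero) (¬Edge⇒≡0 (λ e → x≁ρ u (Edge-sym e))))) ⟩
      A (ρ u) x * y zero + (A (ρ u) x′ * y (suc zero) + rowTail (ρ u))  ≡⟨ null (suc (suc u)) ⟩
      0ℝ                                                           ∎
    y₀≡0 : y zero ≡ 0ℝ
    y₀≡0 = x≢0∧x*y≡0⇒y≡0 (Edge⇒≢0 (Edge-sym x-x′)) (begin
      A x′ x * y zero                                          ≡⟨ sym (+-identityʳ _) ⟩
      A x′ x * y zero + 0ℝ                                     ≡⟨ cong (A x′ x * y zero +_) (sym x′-row-tail) ⟩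
      A x′ x * y zero + (A x′ x′ * y (suc zero) + rowTail x′)     ≡⟨ null (suc zero) ⟩
      0ℝ                                                       ∎)
      where
      x′-row-tail : A x′ x′ * y (suc zero) + rowTail x′ ≡ 0ℝ
      x′-row-tail = trans (drop _ (y≡0⇒x*y≡0 (A x′ x′) y₁≡0)) (sum-zero (λ t → y≡0⇒x*y≡0 _ (rest≡0 t)))
    y≡0 : ∀ t → y t ≡ 0ℝ
    y≡0 zero = y₀≡0
    y≡0 (suc zero) = y₁≡0
    y≡0 (suc (suc t)) = rest≡0 t

  triangular⇒rank≥ : ∀ {s} ps → IsTriangular ps → RankAtMost A s → twice (length ps) ≤ s
  triangular⇒rank≥ ps triangular = nonsingularMinor⇒rank≥ A (vertex ps) (triangular⇒nonsingular ps triangular)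

module PathMatchings {n : ℕ} (G : Graph n) where
  open Nat using (_+_; _∸_)
  open PathsIn G
  open Matchings G

  Spaced : ℕ → ℕ → List ℕ → Set
  Spaced l h [] = ⊤
  Spaced l h (m ∷ ms) = l ≤ m × suc (suc m) ≤ h × Spaced (suc (suc m)) h ms

  Spaced-weakenˡ : ∀ {l l′ h} ms → l′ ≤ l → Spaced l h ms → Spaced l′ h ms
  Spaced-weakenˡ [] _ _ = tt
  Spaced-weakenˡ (m ∷ ms) l′≤l (l≤m , rest) = ℕP.≤-trans l′≤l l≤m , rest

  Spaced-weakenʳ : ∀ {l h h′} ms → h ≤ h′ → Spaced l h ms → Spaced l h′ ms
  Spaced-weakenʳ [] _ _ = tt
  Spaced-weakenʳ (m ∷ ms) h≤h′ (l≤m , m+2≤h , rest) = l≤m , ℕP.≤-trans m+2≤h h≤h′ , Spaced-weakenʳ ms h≤h′ rest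

  Spaced-++ : ∀ {l mid h} xs ys → Spaced l mid xs → mid ≤ h → Spaced mid h ys → l ≤ mid → Spaced l h (xs ++ ys)
  Spaced-++ [] ys _ _ spaced-ys l≤mid = Spaced-weakenˡ ys l≤mid spaced-ys
  Spaced-++ (x ∷ xs) ys (l≤x , x+2≤mid , spaced-xs) mid≤h spaced-ys _ =
    l≤x , ℕP.≤-trans x+2≤mid mid≤h , Spaced-++ xs ys spaced-xs mid≤h spaced-ys x+2≤mid

  Spaced⇒All : ∀ {P : ℕ → Set} {l h} ms → Spaced l h ms → (∀ j → l ≤ j → j < h → P j) → All (λ m → P m × P (suc m)) ms
  Spaced⇒All [] _ _ = []
  Spaced⇒All (m ∷ ms) (l≤m , m+2≤h , spaced) inRange =
    (inRange m l≤m (ℕP.<-trans (ℕP.n<1+n _) m+2≤h) , inRange (suc m) (ℕP.m≤n⇒m≤1+n l≤m) m+2≤h) ∷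
    Spaced⇒All ms spaced (λ j m+2≤j → inRange j (ℕP.≤-trans l≤m (ℕP.m+n≤o⇒n≤o 2 m+2≤j)))

  evensFrom : ℕ → ℕ → List ℕ
  evensFrom s zero = []
  evensFrom s (suc c) = s ∷ evensFrom (suc (suc s)) c

  length-evensFrom : ∀ s c → length (evensFrom s c) ≡ c
  length-evensFrom s zero = refl
  length-evensFrom s (suc c) = cong suc (length-evensFrom (suc (suc s)) c)

  Spaced-evensFrom : ∀ s c → Spaced s (s + twice c) (evensFrom s c)
  Spaced-evensFrom s zero = tt
  Spaced-evensFrom s (suc c) =
    ℕP.≤-refl , subst (suc (suc s) ≤_) s+2+2c (s≤s (s≤s (ℕP.m≤m+n s (twice c)))) ,
    subst (λ h → Spaced (suc (suc s)) h (evensFrom (suc (suc s)) c)) s+2+2c (Spaced-evensFrom (suc (suc s)) c)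
    where
    s+2+2c : suc (suc s) + twice c ≡ s + twice (suc c)
    s+2+2c = sym (trans (ℕP.+-suc s (suc (twice c))) (cong suc (ℕP.+-suc s (twice c))))

  pathPairs : (ℕ → Fin n) → List ℕ → Pairs
  pathPairs V [] = []
  pathPairs V (m ∷ ms) = (V m , V (suc m)) ∷ pathPairs V ms

  length-pathPairs : ∀ V ms → length (pathPairs V ms) ≡ length ms
  length-pathPairs V [] = refl
  length-pathPairs V (m ∷ ms) = cong suc (length-pathPairs V ms)

  All-endpoints : ∀ {P : Fin n → Set} V ms → All (λ m → P (V m) × P (V (suc m))) ms → All P (endpoints (pathPairs V ms))
  All-endpoints V [] [] = []
  All-endpoints V (m ∷ ms) ((pm , pm+1) ∷ rest) = pm ∷ pm+1 ∷ All-endpoints V ms rest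

  ¬adjacent-pathPairs : ∀ {V} x l h → (∀ j → l ≤ j → j < h → ¬ Edge G x (V j)) → ∀ ms → Spaced l h ms →
                        All (λ z → ¬ Edge G x z) (endpoints (pathPairs V ms))
  ¬adjacent-pathPairs x l h x≁V ms spaced = All-endpoints _ ms (Spaced⇒All ms spaced x≁V)

  pathPairs-triangular : ∀ {K V} → IsPathℕ K V → IsInducedℕ K V → ∀ l ms → Spaced l (suc K) ms →
                         IsTriangular (pathPairs V ms)
  pathPairs-triangular pathV ind l [] _ = tt
  pathPairs-triangular {K} {V} pathV@(_ , edge) ind l (m ∷ ms) (_ , m+2≤1+K , spaced) =
    edge m (ℕP.≤-pred m+2≤1+K) ,
    ¬adjacent-pathPairs (V m) (suc (suc m)) (suc K) Vm≁ ms spaced ,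
    pathPairs-triangular pathV ind (suc (suc m)) ms spaced
    where
    Vm≁ : ∀ i → suc (suc m) ≤ i → i < suc K → ¬ Edge G (V m) (V i)
    Vm≁ i m+2≤i (s≤s i≤K) e with ind m i (ℕP.≤-trans (ℕP.n≤1+n m) (ℕP.≤-pred m+2≤1+K)) i≤K e
    ... | inj₁ refl = ℕP.<-asym m+2≤i (ℕP.≤-trans (ℕP.n<1+n _) (ℕP.n≤1+n _))
    ... | inj₂ refl = ℕP.<-irrefl refl m+2≤i

-- The minimum skew rank of a path

IsPathGraph : ∀ {k} → Graph (suc k) → Set
IsPathGraph {k} H = IsInduced H k (λ i → i) × (∀ i j → toℕ j ≡ suc (toℕ i) → Edge H i j)

module PathMatrix (R : RealNumbers) where
  open RealNumbers R
  open SkewRank R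
  open LinearAlgebra R
  open ≡-Reasoning

  δℕ : ℕ → ℕ → ℝ
  δℕ zero zero = 1ℝ
  δℕ zero (suc b) = 0ℝ
  δℕ (suc a) zero = 0ℝ
  δℕ (suc a) (suc b) = δℕ a b

  δℕ-refl : ∀ a → δℕ a a ≡ 1ℝ
  δℕ-refl zero = refl
  δℕ-refl (suc a) = δℕ-refl a

  δℕ-≢ : ∀ {a b} → a ≢ b → δℕ a b ≡ 0ℝ
  δℕ-≢ {zero} {zero} a≢b = ⊥-elim (a≢b refl)
  δℕ-≢ {zero} {suc b} _ = refl
  δℕ-≢ {suc a} {zero} _ = refl
  δℕ-≢ {suc a} {suc b} a≢b = δℕ-≢ (λ a≡b → a≢b (cong suc a≡b))

  δℕ-sym : ∀ a b → δℕ a b ≡ δℕ b a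
  δℕ-sym zero zero = refl
  δℕ-sym zero (suc b) = refl
  δℕ-sym (suc a) zero = refl
  δℕ-sym (suc a) (suc b) = δℕ-sym a b

  -- The signed adjacency matrix of the path 0, 1, …, k: +1 at (i, i+1) and -1 at (i+1, i).
  pathMatrix : ∀ k → Matrix (suc k) (suc k)
  pathMatrix k i j = δℕ (toℕ j) (suc (toℕ i)) + - δℕ (toℕ i) (suc (toℕ j))

  private
    n≢2+n : ∀ a → a ≢ suc (suc a)
    n≢2+n a a≡2+a = ℕP.<-irrefl a≡2+a (ℕP.≤-trans (ℕP.n<1+n a) (ℕP.n≤1+n _))

  pathMatrix-forward : ∀ {k i j} → toℕ j ≡ suc (toℕ i) → pathMatrix k i j ≡ 1ℝ
  pathMatrix-forward {i = i} {j} j≡1+i = begin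
    δℕ (toℕ j) (suc (toℕ i)) + - δℕ (toℕ i) (suc (toℕ j))
      ≡⟨ cong₂ (λ a b → a + - b) (trans (cong (λ a → δℕ a _) j≡1+i) (δℕ-refl (suc (toℕ i))))
                                 (δℕ-≢ (λ e → n≢2+n (toℕ i) (trans e (cong suc j≡1+i)))) ⟩
    1ℝ + - 0ℝ  ≡⟨ cong (1ℝ +_) -0#≈0# ⟩
    1ℝ + 0ℝ    ≡⟨ +-identityʳ 1ℝ ⟩
    1ℝ         ∎

  pathMatrix-backward : ∀ {k i j} → toℕ i ≡ suc (toℕ j) → pathMatrix k i j ≡ - 1ℝ
  pathMatrix-backward {i = i} {j} i≡1+j = begin
    δℕ (toℕ j) (suc (toℕ i)) + - δℕ (toℕ i) (suc (toℕ j))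
      ≡⟨ cong₂ (λ a b → a + - b) (δℕ-≢ (λ e → n≢2+n (toℕ j) (trans e (cong suc i≡1+j))))
                                 (trans (cong (λ a → δℕ a _) i≡1+j) (δℕ-refl (suc (toℕ j)))) ⟩
    0ℝ + - 1ℝ  ≡⟨ +-identityˡ _ ⟩
    - 1ℝ       ∎

  pathMatrix-far : ∀ {k i j} → toℕ j ≢ suc (toℕ i) → toℕ i ≢ suc (toℕ j) → pathMatrix k i j ≡ 0ℝ
  pathMatrix-far j≢1+i i≢1+j = begin
    _           ≡⟨ cong₂ (λ a b → a + - b) (δℕ-≢ j≢1+i) (δℕ-≢ i≢1+j) ⟩
    0ℝ + - 0ℝ   ≡⟨ +-identityˡ _ ⟩
    - 0ℝ        ≡⟨ -0#≈0# ⟩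
    0ℝ          ∎

  pathMatrix∈S⁻ : ∀ {k} (H : Graph (suc k)) → IsPathGraph H → InSkew H (pathMatrix k)
  pathMatrix∈S⁻ {k} H (edge⇒consecutive , consecutive⇒edge) = skew , λ i j _ → ≢0⇒edge i j , edge⇒≢0 i j
    where
    skew : ∀ i j → pathMatrix k i j ≡ - pathMatrix k j i
    skew i j = begin
      x + - y        ≡⟨ +-comm x (- y) ⟩
      - y + x        ≡⟨ cong (- y +_) (sym (-‿involutive x)) ⟩
      - y + - (- x)  ≡⟨ -‿+-comm y (- x) ⟩
      - (y + - x)    ∎
      where
      x = δℕ (toℕ j) (suc (toℕ i))
      y = δℕ (toℕ i) (suc (toℕ j))
    ≢0⇒edge : ∀ i j → pathMatrix k i j ≢ 0ℝ → Edge H i j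
    ≢0⇒edge i j ≢0 with toℕ j Nat.≟ suc (toℕ i) | toℕ i Nat.≟ suc (toℕ j)
    ... | yes j≡1+i | _ = consecutive⇒edge i j j≡1+i
    ... | no _ | yes i≡1+j = trans (Graph.sym H i j) (consecutive⇒edge j i i≡1+j)
    ... | no j≢1+i | no i≢1+j = ⊥-elim (≢0 (pathMatrix-far j≢1+i i≢1+j))
    edge⇒≢0 : ∀ i j → Edge H i j → pathMatrix k i j ≢ 0ℝ
    edge⇒≢0 i j e with edge⇒consecutive i j e
    ... | inj₁ i≡1+j = λ ≡0 → -x≢0 1≢0 (trans (sym (pathMatrix-backward i≡1+j)) ≡0)
    ... | inj₂ j≡1+i = λ ≡0 → 1≢0 (trans (sym (pathMatrix-forward j≡1+i)) ≡0)

  ∑-δℕ : ∀ {k} (f : ℕ → ℝ) m → m ≤ suc k → f (suc k) ≡ 0ℝ → ∑[ j < suc k ] (δℕ (toℕ j) m * f (toℕ j)) ≡ f m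
  ∑-δℕ {k} f m m≤1+k f[1+k]≡0 with ℕP.m≤n⇒m<n∨m≡n m≤1+k
  ... | inj₂ refl =
    trans (sum-zero (λ j → x≡0⇒x*y≡0 (f (toℕ j)) (δℕ-≢ {toℕ j} {suc k} (ℕP.<⇒≢ (FP.toℕ<n j))))) (sym f[1+k]≡0)
  ... | inj₁ (s≤s m≤k) = begin
    ∑[ j < suc k ] (δℕ (toℕ j) m * f (toℕ j))  ≡⟨ sum-single (clamp k m) others ⟩
    δℕ (toℕ (clamp k m)) m * f (toℕ (clamp k m)) ≡⟨ cong (λ a → δℕ a m * f a) (toℕ-clamp k m m≤k) ⟩
    δℕ m m * f m                               ≡⟨ cong (_* f m) (δℕ-refl m) ⟩
    1ℝ * f m                                   ≡⟨ *-identityˡ (f m) ⟩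
    f m                                        ∎
    where
    others : ∀ j → j ≢ clamp k m → δℕ (toℕ j) m * f (toℕ j) ≡ 0ℝ
    others j j≢ = x≡0⇒x*y≡0 _ (δℕ-≢ (λ j≡m → j≢ (trans (sym (clamp-toℕ k j)) (cong (clamp k) j≡m))))

  alternating : ℕ → ℝ
  alternating zero = 1ℝ
  alternating (suc zero) = 0ℝ
  alternating (suc (suc m)) = alternating m

  alternating-odd : ∀ c → alternating (suc (twice c)) ≡ 0ℝ
  alternating-odd zero = refl
  alternating-odd (suc c) = alternating-odd c

  pathMatrix-alternating : ∀ c → IsNullVector (pathMatrix (twice c)) (λ j → alternating (toℕ j))
  pathMatrix-alternating c i = begin
    ∑[ j < suc k ] (pathMatrix k i j * z j)
      ≡⟨ sum-cong-≗ (λ j → distribʳ (z j) (δℕ (toℕ j) (suc (toℕ i))) (- δℕ (toℕ i) (suc (toℕ j)))) ⟩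
    ∑[ j < suc k ] (δℕ (toℕ j) (suc (toℕ i)) * z j + - δℕ (toℕ i) (suc (toℕ j)) * z j)
      ≡⟨ ∑-distrib-+ (λ j → δℕ (toℕ j) (suc (toℕ i)) * z j) (λ j → - δℕ (toℕ i) (suc (toℕ j)) * z j) ⟩
    ∑[ j < suc k ] (δℕ (toℕ j) (suc (toℕ i)) * z j) + ∑[ j < suc k ] (- δℕ (toℕ i) (suc (toℕ j)) * z j)
      ≡⟨ cong₂ _+_ (∑-δℕ alternating (suc (toℕ i)) (FP.toℕ<n i) (alternating-odd c))
                   (trans (sum-cong-≗ (λ j → sym (-‿distribˡ-* (δℕ (toℕ i) (suc (toℕ j))) (z j))))
                          (∑-neg (λ j → δℕ (toℕ i) (suc (toℕ j)) * z j))) ⟩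
    alternating (suc (toℕ i)) + - (∑[ j < suc k ] (δℕ (toℕ i) (suc (toℕ j)) * z j))
      ≡⟨ cong (λ a → alternating (suc (toℕ i)) + - a) (backward (toℕ i) (ℕP.≤-pred (FP.toℕ<n i))) ⟩
    alternating (suc (toℕ i)) + - alternating (suc (toℕ i))
      ≡⟨ -‿inverseʳ _ ⟩
    0ℝ ∎
    where
    k = twice c
    z : Fin (suc k) → ℝ
    z j = alternating (toℕ j)
    backward : ∀ a → a ≤ k → ∑[ j < suc k ] (δℕ a (suc (toℕ j)) * z j) ≡ alternating (suc a)
    backward zero _ = sum-zero (λ j → zeroˡ (z j))
    backward (suc a) a<k = trans (sum-cong-≗ (λ j → cong (_* z j) (δℕ-sym a (toℕ j))))
                                 (∑-δℕ alternating a (ℕP.≤-trans (ℕP.n≤1+n a) (ℕP.m≤n⇒m≤1+n a<k)) (alternating-odd c))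

  pathMatrix-rank : ∀ {k} (H : Graph (suc k)) → IsPathGraph H → Rank (pathMatrix k) (twice ⌊ suc k /2⌋)
  pathMatrix-rank {k} H pathGraph@(_ , consecutive⇒edge) = rank≤ (twice⌊n/2⌋-parity (suc k)) , rank≥
    where
    open PathsIn H using (IsPath⇒IsPathℕ; IsInduced⇒IsInducedℕ)
    open PathMatchings H using (pathPairs; evensFrom; length-pathPairs; length-evensFrom; pathPairs-triangular;
                                Spaced-weakenʳ; Spaced-evensFrom)
    c = ⌊ suc k /2⌋
    rank≤ : suc k ≡ twice c ⊎ suc k ≡ suc (twice c) → RankAtMost (pathMatrix k) (twice c)
    rank≤ (inj₁ 1+k≡2c) = subst (RankAtMost (pathMatrix k)) 1+k≡2c (rank≤size (pathMatrix k))
    rank≤ (inj₂ 1+k≡1+2c) = subst (λ m → RankAtMost (pathMatrix m) (twice c)) (sym (ℕP.suc-injective 1+k≡1+2c))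
                              (nullVector⇒rank≤ (pathMatrix (twice c)) (λ j → alternating (toℕ j)) 1≢0
                                 (pathMatrix-alternating c))
    identityPath : IsPath H k (λ i → i)
    identityPath = (λ i≡j → i≡j) , λ i → consecutive⇒edge (inject₁ i) (suc i) (cong suc (sym (FP.toℕ-inject₁ i)))
    ps = pathPairs (clamp k) (evensFrom 0 c)
    rank≥ : ∀ s → RankAtMost (pathMatrix k) s → twice c ≤ s
    rank≥ s rank≤s = subst (λ m → twice m ≤ s) (trans (length-pathPairs (clamp k) (evensFrom 0 c)) (length-evensFrom 0 c))
      (SkewMatrices.triangular⇒rank≥ R H (pathMatrix k) (pathMatrix∈S⁻ H pathGraph) ps
         (pathPairs-triangular (IsPath⇒IsPathℕ identityPath) (IsInduced⇒IsInducedℕ (proj₁ pathGraph)) 0 (evensFrom 0 c)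
            (Spaced-weakenʳ (evensFrom 0 c) (twice⌊n/2⌋≤n (suc k)) (Spaced-evensFrom 0 c)))
         rank≤s)

  mr⁻-path≤ : ∀ {k r} (H : Graph (suc k)) → IsPathGraph H → MinSkewRank H r → r ≤ twice ⌊ suc k /2⌋
  mr⁻-path≤ {k} H pathGraph (_ , minimal) = minimal (pathMatrix k) _ (pathMatrix∈S⁻ H pathGraph) (pathMatrix-rank H pathGraph)


-- Lower bounds on the minimum skew rank

triangular⇒mr⁻≥ : ∀ (R : RealNumbers) {n r} (G : Graph n) → SkewRank.MinSkewRank R G r →
                  ∀ ps → Matchings.IsTriangular G ps → twice (length ps) ≤ r
triangular⇒mr⁻≥ R G ((A , A∈S⁻ , rank≤ , _) , _) ps triangular =
  SkewMatrices.triangular⇒rank≥ R G A A∈S⁻ ps triangular rank≤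

module AlongInducedPath (R : RealNumbers) {n : ℕ} (G : Graph n) {r : ℕ} (mr : SkewRank.MinSkewRank R G r)
                        {K : ℕ} {V : ℕ → Fin n} (pathV : PathsIn.IsPathℕ G K V) (indV : PathsIn.IsInducedℕ G K V) where
  open Nat using (_+_; _∸_)
  open PathsIn G
  open Matchings G
  open PathMatchings G

  offPathEdge⇒mr⁻≥ : ∀ {x y} → Edge G x y → (∀ i → i ≤ K → ¬ Edge G x (V i)) → suc (suc (twice ⌊ suc K /2⌋)) ≤ r
  offPathEdge⇒mr⁻≥ {x} {y} x-y x≁V =
    subst (λ m → twice m ≤ r) (cong suc (trans (length-pathPairs V ms) (length-evensFrom 0 c)))
      (triangular⇒mr⁻≥ R G mr ((x , y) ∷ pathPairs V ms)
        (x-y , ¬adjacent-pathPairs x 0 (suc K) (λ j _ j<1+K → x≁V j (ℕP.≤-pred j<1+K)) ms spaced ,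
         pathPairs-triangular pathV indV 0 ms spaced))
    where
    c = ⌊ suc K /2⌋
    ms = evensFrom 0 c
    spaced : Spaced 0 (suc K) ms
    spaced = Spaced-weakenʳ ms (twice⌊n/2⌋≤n (suc K)) (Spaced-evensFrom 0 c)

  -- The triangular matching: (a, V i), (b, V (i+1)), then maximum matchings of V[0, i) and V[i+2, K].
  adjacentLegs⇒mr⁻> : Acyclic G → ∀ {a b i} → i < K → ¬ OnPathℕ K V a → ¬ OnPathℕ K V b →
                      Edge G a (V i) → Edge G b (V (suc i)) → K < r
  adjacentLegs⇒mr⁻> acyclic {a} {b} {i} i<K a-off b-off a-Vi b-Vi+1 =
    ℕP.<-≤-trans K<4+2c₁+2c₂ (subst (λ m → suc (suc (suc (suc m))) ≤ r) (twice-+ c₁ c₂)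
      (subst (λ m → twice m ≤ r) lengths (triangular⇒mr⁻≥ R G mr ps triangular)))
    where
    open InAcyclic acyclic using (attached-unique; ¬attachedEdge)
    i≤K = ℕP.<⇒≤ i<K
    c₁ = ⌊ i /2⌋
    c₂ = ⌊ K ∸ suc i /2⌋
    left = evensFrom 0 c₁
    right = evensFrom (suc (suc i)) c₂
    ms = left ++ right
    ps = (a , V i) ∷ (b , V (suc i)) ∷ pathPairs V ms
    lengths : length ps ≡ suc (suc (c₁ + c₂))
    lengths = cong (λ m → suc (suc m)) (trans (length-pathPairs V ms)
                (trans (LP.length-++ left) (cong₂ _+_ (length-evensFrom 0 c₁) (length-evensFrom _ c₂))))
    K<4+2c₁+2c₂ : K < suc (suc (suc (suc (twice c₁ + twice c₂))))
    K<4+2c₁+2c₂ = begin-strict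
      K                                        ≡⟨ sym (ℕP.m+[n∸m]≡n i<K) ⟩
      suc i + (K ∸ suc i)                      ≤⟨ ℕP.+-mono-≤ (s≤s (n≤1+twice⌊n/2⌋ i)) (n≤1+twice⌊n/2⌋ (K ∸ suc i)) ⟩
      suc (suc (twice c₁)) + suc (twice c₂)    ≡⟨ cong (λ m → suc (suc m)) (ℕP.+-suc (twice c₁) (twice c₂)) ⟩
      suc (suc (suc (twice c₁ + twice c₂)))    <⟨ ℕP.n<1+n _ ⟩
      suc (suc (suc (suc (twice c₁ + twice c₂)))) ∎
      where open ℕP.≤-Reasoning
    spacedL : Spaced 0 i left
    spacedL = Spaced-weakenʳ left (twice⌊n/2⌋≤n i) (Spaced-evensFrom 0 c₁)
    spacedR : Spaced (suc (suc i)) (suc K) right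
    spacedR = Spaced-weakenʳ right (s≤s (ℕP.≤-trans (ℕP.+-monoʳ-≤ (suc i) (twice⌊n/2⌋≤n (K ∸ suc i)))
                                                    (ℕP.≤-reflexive (ℕP.m+[n∸m]≡n i<K))))
                (Spaced-evensFrom (suc (suc i)) c₂)
    spaced : Spaced 0 (suc K) ms
    spaced = Spaced-++ left right (Spaced-weakenʳ left (ℕP.≤-trans (ℕP.n≤1+n i) (ℕP.n≤1+n _)) spacedL) (s≤s i<K) spacedR z≤n
    only-foot : ∀ {x f} → ¬ OnPathℕ K V x → f ≤ K → Edge G x (V f) → ∀ j → j ≤ K → j ≢ f → ¬ Edge G x (V j)
    only-foot x-off f≤K x-Vf j j≤K j≢f x-Vj = j≢f (attached-unique pathV x-off j≤K f≤K x-Vj x-Vf)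
    ≁matching : ∀ {x f} → ¬ OnPathℕ K V x → f ≤ K → Edge G x (V f) → f ≡ i ⊎ f ≡ suc i →
                All (λ z → ¬ Edge G x z) (endpoints (pathPairs V ms))
    ≁matching {x} {f} x-off f≤K x-Vf f∈ = All-endpoints V ms (AllP.++⁺
      (Spaced⇒All left spacedL (λ j _ j<i → only-foot x-off f≤K x-Vf j (ℕP.<⇒≤ (ℕP.<-trans j<i i<K)) (below j<i f∈)))
      (Spaced⇒All right spacedR (λ j i+2≤j j<1+K → only-foot x-off f≤K x-Vf j (ℕP.≤-pred j<1+K) (above i+2≤j f∈))))
      where
      below : ∀ {j} → j < i → f ≡ i ⊎ f ≡ suc i → j ≢ f
      below j<i (inj₁ refl) = ℕP.<⇒≢ j<i
      below j<i (inj₂ refl) = ℕP.<⇒≢ (ℕP.m<n⇒m<1+n j<i)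
      above : ∀ {j} → suc (suc i) ≤ j → f ≡ i ⊎ f ≡ suc i → j ≢ f
      above i+2≤j (inj₁ refl) = ℕP.>⇒≢ (ℕP.<-trans (ℕP.n<1+n i) i+2≤j)
      above i+2≤j (inj₂ refl) = ℕP.>⇒≢ i+2≤j
    triangular : IsTriangular ps
    triangular =
      a-Vi ,
      (λ a-b → ¬attachedEdge pathV a-off b-off i≤K i<K a-b a-Vi b-Vi+1) ∷
      (λ a-Vi+1 → ℕP.<⇒≢ (ℕP.n<1+n i) (attached-unique pathV a-off i≤K i<K a-Vi a-Vi+1)) ∷
      ≁matching a-off i≤K a-Vi (inj₁ refl) ,
      b-Vi+1 , ≁matching b-off i<K b-Vi+1 (inj₂ refl) ,
      pathPairs-triangular pathV indV 0 ms spaced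

-- Trees whose edges all touch a diametrical path

module DiametricalPath {n : ℕ} (T : Graph n) {k : ℕ} {p : Fin (suc k) → Fin n} (diametrical : IsDiametricalPath T k p) where
  open Nat using (_∸_)
  open PathsIn T

  P : ℕ → Fin n
  P j = p (clamp k j)

  pathP : IsPathℕ k P
  pathP = IsPath⇒IsPathℕ (proj₁ diametrical)

  indP : IsInducedℕ k P
  indP = IsInduced⇒IsInducedℕ (proj₁ (proj₂ diametrical))

  diameter : ∀ u w e → Dist T u w e → e ≤ k
  diameter = proj₂ (proj₂ (proj₂ diametrical))

  p≡P∘toℕ : ∀ j → p j ≡ P (toℕ j)
  p≡P∘toℕ j = cong p (sym (clamp-toℕ k j))

  ¬OnSpine⇒¬OnPathℕ : ∀ {v} → ¬ OnSpine p v → ¬ OnPathℕ k P v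
  ¬OnSpine⇒¬OnPathℕ off (m , _ , Pm≡v) = off (clamp k m , Pm≡v)

  joint⇒leg : ∀ {j} → IsJoint T k p j → ∃[ v ] (¬ OnPathℕ k P v × Edge T v (P (toℕ j)))
  joint⇒leg {j} (v , off , pj-v) = v , ¬OnSpine⇒¬OnPathℕ off , Edge-sym (subst (λ x → Edge T x v) (p≡P∘toℕ j) pj-v)

  inducedOn-pathGraph : IsPathGraph (inducedOn T p)
  inducedOn-pathGraph = proj₁ (proj₂ diametrical) , consecutive⇒edge
    where
    consecutive⇒edge : ∀ i j → toℕ j ≡ suc (toℕ i) → Edge T (p i) (p j)
    consecutive⇒edge i j j≡1+i = subst₂ (λ a b → Edge T (p a) (p b)) (clamp-toℕ k i)
                                   (trans (cong (clamp k) (sym j≡1+i)) (clamp-toℕ k j))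
                                   (proj₂ pathP (toℕ i) (subst (_≤ k) j≡1+i (ℕP.≤-pred (FP.toℕ<n j))))

  module _ (tree : IsTree T) (noOffPathEdge : ∀ {x y} → Edge T x y → (∀ i → i ≤ k → ¬ Edge T x (P i)) → ⊥) where
    open InAcyclic (proj₂ (proj₂ tree))

    attached⇒pendant : ∀ {v i} → ¬ OnPathℕ k P v → i ≤ k → Edge T (P i) v → ∀ w → Edge T v w → w ≡ P i
    attached⇒pendant {v} {i} v-off i≤k Pi-v w v-w with w F.≟ P i | onPathℕ? k P w
    ... | yes w≡Pi | _ = w≡Pi
    ... | no w≢Pi | yes (m , m≤k , Pm≡w) =
      ⊥-elim (w≢Pi (trans (sym Pm≡w) (cong P (attached-unique pathP v-off m≤k i≤k (subst (Edge T v) (sym Pm≡w) v-w) (Edge-sym Pi-v)))))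
    ... | no _ | no w-off = ⊥-elim (noOffPathEdge (Edge-sym v-w)
                              (λ m m≤k w-Pm → ¬attachedEdge pathP w-off v-off m≤k i≤k (Edge-sym v-w) w-Pm (Edge-sym Pi-v)))

    attached⇒leg : ∀ {v i} → ¬ OnPathℕ k P v → i ≤ k → Edge T (P i) v →
                   ∃[ j ] ((0 < toℕ j × toℕ j < k) × Edge T (p j) v × (∀ w → Edge T v w → w ≡ p j))
    attached⇒leg {v} {i} v-off i≤k Pi-v with i Nat.≟ 0 | i Nat.≟ k | attached⇒pendant v-off i≤k Pi-v
    ... | yes refl | _ | pendant = ⊥-elim (noPendantAtStart diameter pathP indP v-off (Edge-sym Pi-v) pendant)
    ... | no _ | yes refl | pendant =
      ⊥-elim (noPendantAtStart diameter (reverse-IsPathℕ pathP) (reverse-IsInducedℕ indP) reverse-off (Edge-sym Pi-v) pendant)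
      where
      reverse-off : ¬ OnPathℕ i (reverseℕ i P) v
      reverse-off (j , _ , e) = v-off (i ∸ j , ℕP.m∸n≤m i j , e)
    ... | no i≢0 | no i≢k | pendant =
      clamp k i , (subst (0 <_) (sym i≡) (ℕP.n≢0⇒n>0 i≢0) , subst (_< k) (sym i≡) (ℕP.≤∧≢⇒< i≤k i≢k)) , Pi-v , pendant
      where
      i≡ : toℕ (clamp k i) ≡ i
      i≡ = toℕ-clamp k i i≤k

    ¬unattached : ∀ {v} → ¬ OnSpine p v → (∀ i → i ≤ k → ¬ Edge T v (P i)) → ⊥
    ¬unattached {v} off unattached with proj₁ (proj₂ tree) v (p zero)
    ... | zero , q , (_ , q0≡v , q0≡p0) = off (zero , trans (sym q0≡p0) q0≡v)
    ... | suc _ , q , ((_ , edge) , q0≡v , _) = noOffPathEdge (subst (λ x → Edge T x (q (suc zero))) q0≡v (edge zero)) unattached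

    centipedeSpine : IsCentipedeSpine T k p
    centipedeSpine = proj₁ diametrical , proj₁ (proj₂ diametrical) , leg
      where
      leg : ∀ v → ¬ OnSpine p v → ∃[ j ] ((0 < toℕ j × toℕ j < k) × Edge T (p j) v × (∀ w → Edge T v w → w ≡ p j))
      leg v off with Nat.anyUpTo? (λ i → adj T (P i) v BP.≟ true) (suc k)
      ... | yes (i , s≤s i≤k , Pi-v) = attached⇒leg (¬OnSpine⇒¬OnPathℕ off) i≤k Pi-v
      ... | no none = ⊥-elim (¬unattached off (λ i i≤k v-Pi → none (i , s≤s i≤k , Edge-sym v-Pi)))

lemma4p1 : (R : RealNumbers) → (n : ℕ) → (T : Graph n) → IsTree T →
    (k : ℕ) → (p : Fin (suc k) → Fin n) → IsDiametricalPath T k p →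
    (r : ℕ) → SkewRank.MinSkewRank R T r → SkewRank.MinSkewRank R (inducedOn T p) r →
    IsCentipede T × (suc k % 2 ≡ 1 → IsRegularCentipede T)
lemma4p1 R n T tree k p diametrical r mrT mrP = (k , p , spine) , λ odd → k , p , spine , noAdjacentJoints odd
  where
  open DiametricalPath T diametrical
  open AlongInducedPath R T mrT pathP indP
  r≤2⌊[k+1]/2⌋ : r ≤ twice ⌊ suc k /2⌋
  r≤2⌊[k+1]/2⌋ = PathMatrix.mr⁻-path≤ R (inducedOn T p) inducedOn-pathGraph mrP
  spine : IsCentipedeSpine T k p
  spine = centipedeSpine tree λ x-y x≁P →
    ℕP.<-irrefl refl (ℕP.≤-trans (ℕP.≤-trans (ℕP.n≤1+n _) (offPathEdge⇒mr⁻≥ x-y x≁P)) r≤2⌊[k+1]/2⌋)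
  noAdjacentJoints : suc k % 2 ≡ 1 → ∀ (i : Fin k) → ¬ (IsJoint T k p (inject₁ i) × IsJoint T k p (suc i))
  noAdjacentJoints odd i (joint-i , joint-i+1) with joint⇒leg joint-i | joint⇒leg joint-i+1
  ... | a , a-off , a-Pi | b , b-off , b-Pi+1 =
    ℕP.<-irrefl refl (ℕP.<-≤-trans
      (adjacentLegs⇒mr⁻> (proj₂ (proj₂ tree)) (FP.toℕ<n i) a-off b-off (subst (Edge T a ∘ P) (FP.toℕ-inject₁ i) a-Pi) b-Pi+1)
      (subst (r ≤_) (odd⇒twice⌊1+n/2⌋≡n k odd) r≤2⌊[k+1]/2⌋))
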